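{- Let $q$ be a prime power, $n\ge 2$, and let $f,g$ be $q$-polynomials over $\mathbb{F}_{q^n}$ (i.e. $f(x)=\sum_{i=0}^{n-1}a_ix^{q^i}$, $g(x)=\sum_{i=0}^{n-1}b_ix^{q^i}$ with $a_i,b_i\in\mathbb{F}_{q^n}$). Regard $F(Y)=f(x)Y-g(Y)x$ as a $q$-polynomial in the variable $Y$ whose coefficients lie in $\mathbb{F}_{q^n}[x]$, and let $D_{F(Y)}(x)$ be its Dickson matrix. Then $L_f\subseteq L_g$ if and only if \[x^{q^n}-x \mid \det D_{F(Y)}(x)\in\mathbb{F}_{q^n}[x].\] In particular, if $\deg \det D_{F(Y)}(x)<q^n$, then $L_f\subseteq L_g$ if and only if $\det D_{F(Y)}(x)$ is the zero polynomial.
   Context: For an $\mathbb{F}_q$-subspace $U$ of $\mathbb{F}_{q^n}^2$, the $\mathbb{F}_q$-linear set $L_U$ is the set of points $\{\langle u\rangle_{\mathbb{F}_{q^n}} : u\in U\setminus\{0\}\}$ of the projective line $\mathrm{PG}(1,q^n)$. For a $q$-polynomial $f$ over $\mathbb{F}_{q^n}$, $U_f=\{(x,f(x)) : x\in\mathbb{F}_{q^n}\}$ and $L_f=L_{U_f}$. For a $q$-polynomial $h(Y)=\sum_{i=0}^{n-1}c_iY^{q^i}$, its Dickson matrix is the $n\times n$ matrix whose entry in row $j$ and column $i$ ($0\le i,j\le n-1$) is $c_{i-j \bmod n}^{\,q^j}$; i.e. the first row is $(c_0,c_1,\dots,c_{n-1})$, the second is $(c_{n-1}^q,c_0^q,\dots,c_{n-2}^q)$,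 ..., the last is $(c_1^{q^{n-1}},c_2^{q^{n-1}},\dots,c_0^{q^{n-1}})$. When the $c_i$ are polynomials in $x$, the powers $c_i^{q^j}$ are taken as polynomials in $x$. -}

module Defs where

open import Level using (0ℓ)
open import Data.Nat as ℕ using (ℕ; zero; suc; _≤_; _≤ᵇ_; _∸_)
open import Data.Nat.Primality using (Prime)
open import Data.Fin as Fin using (Fin; zero; suc; toℕ; punchIn)
open import Data.List using (List; []; _∷_)
open import Data.Product using (Σ; ∃; _×_; _,_)
open import Data.Bool using (if_then_else_)
open import Relation.Binary.PropositionalEquality using (_≡_; _≢_)
open import Relation.Nullary using (¬_)
open import Algebra.Structures using (IsCommutativeRing)

record Field : Set₁ where
  infixl 7 _*_
  infixl 6 _+_
  field
    Carrier : Set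
    _+_ _*_ : Carrier → Carrier → Carrier
    -_      : Carrier → Carrier
    0# 1#   : Carrier
    isCommutativeRing : IsCommutativeRing _≡_ _+_ _*_ -_ 0# 1#
    0≢1     : 0# ≢ 1#
    inverse : ∀ x → x ≢ 0# → ∃ λ y → x * y ≡ 1#

open import Function.Bundles using (_↔_)

HasCardinality : Field → ℕ → Set
HasCardinality K m = Field.Carrier K ↔ Fin m

IsPrimePower : ℕ → Set
IsPrimePower q = Σ ℕ λ p → Σ ℕ λ k → Prime p × 1 ≤ k × q ≡ p ℕ.^ k

module _ (K : Field) where
  open Field K

  pow : Carrier → ℕ → Carrier
  pow x zero    = 1#
  pow x (suc m) = x * pow x m

  sumFin : ∀ {k} → (Fin k → Carrier) → Carrier
  sumFin {zero}  v = 0#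
  sumFin {suc k} v = v zero + sumFin (λ i → v (suc i))

  qPolyEval : (q : ℕ) {n : ℕ} → (Fin n → Carrier) → Carrier → Carrier
  qPolyEval q {n} a x = sumFin (λ (i : Fin n) → a i * pow x (q ℕ.^ toℕ i))

  -- L_f ⊆ L_g : every point ⟨(x, f x)⟩ (x ≠ 0) equals some point ⟨(y, g y)⟩ (y ≠ 0)
  LinSetSubset : (Carrier → Carrier) → (Carrier → Carrier) → Set
  LinSetSubset f g =
    ∀ x → x ≢ 0# →
      ∃ λ y → ∃ λ λ′ → y ≢ 0# × x ≡ λ′ * y × f x ≡ λ′ * g y

  -- Polynomials K[x]: coefficient lists, lowest degree first.

  Poly : Set
  Poly = List Carrier

  coeff : Poly → ℕ → Carrier
  coeff []       _       = 0#
  coeff (c ∷ p)  zero    = c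
  coeff (c ∷ p)  (suc k) = coeff p k

  -- equality of polynomials (coefficientwise; trailing zeros irrelevant)
  _≈P_ : Poly → Poly → Set
  p ≈P r = ∀ k → coeff p k ≡ coeff r k

  IsZeroPoly : Poly → Set
  IsZeroPoly p = ∀ k → coeff p k ≡ 0#

  -- deg p < m  (the zero polynomial counts as having degree < m)
  DegLt : Poly → ℕ → Set
  DegLt p m = ∀ k → m ≤ k → coeff p k ≡ 0#

  constP : Carrier → Poly
  constP c = c ∷ []

  oneP zeroP : Poly
  oneP  = 1# ∷ []
  zeroP = []

  X : Poly
  X = 0# ∷ 1# ∷ []

  addP : Poly → Poly → Poly
  addP []      r       = r
  addP (c ∷ p) []      = c ∷ p
  addP (c ∷ p) (d ∷ r) = (c + d) ∷ addP p r

  negP : Poly → Poly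
  negP []      = []
  negP (c ∷ p) = (- c) ∷ negP p

  subP : Poly → Poly → Poly
  subP p r = addP p (negP r)

  scaleP : Carrier → Poly → Poly
  scaleP a []      = []
  scaleP a (c ∷ p) = (a * c) ∷ scaleP a p

  mulP : Poly → Poly → Poly
  mulP []      r = []
  mulP (c ∷ p) r = addP (scaleP c r) (0# ∷ mulP p r)

  powP : Poly → ℕ → Poly
  powP p zero    = oneP
  powP p (suc m) = mulP p (powP p m)

  _∣P_ : Poly → Poly → Set
  d ∣P p = ∃ λ h → p ≈P mulP d h

  sumFinP : ∀ {k} → (Fin k → Poly) → Poly
  sumFinP {zero}  v = zeroP
  sumFinP {suc k} v = addP (v zero) (sumFinP (λ i → v (suc i)))

  signP : ℕ → Poly → Poly
  signP zero          p = p
  signP (suc zero)    p = negP p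
  signP (suc (suc m)) p = signP m p

  det : ∀ {k} → (Fin k → Fin k → Poly) → Poly
  det {zero}  M = oneP
  det {suc k} M =
    sumFinP (λ (i : Fin (suc k)) →
      signP (toℕ i) (mulP (M zero i) (det (λ r c → M (suc r) (punchIn i c)))))

  -- entry at a natural-number index of a coefficient vector (0 outside range)
  at : ∀ {k} → (Fin k → Carrier) → ℕ → Carrier
  at {zero}  v _       = 0#
  at {suc k} v zero    = v zero
  at {suc k} v (suc m) = at (λ i → v (suc i)) m

  -- (i - j) mod n for i, j < n
  cycIdx : ℕ → ℕ → ℕ → ℕ
  cycIdx n i j = if j ≤ᵇ i then i ∸ j else (n ℕ.+ i) ∸ j

  -- Dickson matrix of h(Y) = Σ_{i<n} c_i Y^{q^i}, c_i ∈ K[x]: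
  -- entry (row j, column i) = c_{(i-j) mod n}^{q^j}  (power in K[x])
  dickson : (q n : ℕ) → (ℕ → Poly) → Fin n → Fin n → Poly
  dickson q n c j i = powP (c (cycIdx n (toℕ i) (toℕ j))) (q ℕ.^ toℕ j)

  qPolyAsPoly : (q : ℕ) {n : ℕ} → (Fin n → Carrier) → Poly
  qPolyAsPoly q {n} a = sumFinP (λ (i : Fin n) → scaleP (a i) (powP X (q ℕ.^ toℕ i)))

  -- coefficients of F(Y) = f(x) Y - g(Y) x as a q-polynomial in Y:
  --   c_0 = f(x) - b_0 x,   c_i = - b_i x  (1 ≤ i < n)
  coeffF : (q : ℕ) {n : ℕ} → (a b : Fin n → Carrier) → ℕ → Poly
  coeffF q a b zero    = subP (qPolyAsPoly q a) (scaleP (at b zero) X)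
  coeffF q a b (suc i) = negP (scaleP (at b (suc i)) X)

  detDicksonF : (q n : ℕ) → (a b : Fin n → Carrier) → Poly
  detDicksonF q n a b = det (dickson q n (coeffF q a b))

  fieldPoly : (q n : ℕ) → Poly
  fieldPoly q n = subP (powP X (q ℕ.^ n)) X

-- For a fixed x ∈ 𝔽_{q^n}, evaluating D_{F(Y)}(x) gives the Dickson matrix of the q-polynomial
-- F_x(y) = f(x) y - x g(y) over 𝔽_{q^n}, and the point ⟨(x, f x)⟩ lies in L_g exactly when F_x has
-- a nonzero root. A q-polynomial has a nonzero root iff its Dickson matrix is singular: a root y
-- gives the kernel vector (y^(q^i))ᵢ, and a kernel vector v gives the roots ∑ᵤ (z vᵤ)^(q^(n-u)),
-- which cannot all vanish since as a polynomial in z it has degree < q^n and a nonzero coefficient.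
-- Hence L_f ⊆ L_g iff det D_F vanishes on all of 𝔽_{q^n}, i.e. iff x^(q^n) - x divides it; when
-- deg det D_F < q^n, vanishing everywhere means det D_F = 0.
module Submission where

open import Defs
open import Level using (0ℓ)
open import Data.Nat as ℕ using (ℕ; zero; suc; NonZero; _%_; _/_; _!; s≤s; z≤n)
import Data.Nat.Properties as ℕ
open import Data.Nat.DivMod
  using (m≡m%n+[m/n]*n; m<n⇒m%n≡m; [m+n]%n≡m%n; m%n%n≡m%n; %-distribˡ-+; n%n≡0; m%n<n; m*n/n≡m; /-congˡ)
open import Data.Nat.Divisibility using (_∣_; divides; ∣1⇒≡1; ∣⇒≤)
open import Data.Nat.Primality using (Prime; euclidsLemma; ¬prime[1]; prime⇒nonTrivial)
open import Data.Nat.Combinatorics using (_C_; nCn≡1; nCk≡n!/k![n-k]!; k![n∸k]!∣n!)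
open import Data.Integer as ℤ using (ℤ; -[1+_])
import Data.Integer.Properties as ℤ
open import Data.Fin as Fin using (Fin; zero; suc; toℕ; punchIn; punchOut; fromℕ<)
import Data.Fin.Properties as Fin
open import Data.Fin.Permutation using (permutation)
open import Data.Vec.Functional using (updateAt)
open import Data.Vec.Functional.Properties using (updateAt-updates; updateAt-minimal)
open import Data.List using ([]; _∷_)
open import Data.Maybe using (Maybe; just; nothing)
open import Data.Product using (Σ; ∃; _×_; _,_; proj₁; proj₂)
open import Data.Sum using (inj₁; inj₂)
open import Data.Empty using (⊥-elim)
open import Data.Bool using (T; true; false)
open import Data.Unit using (tt)
open import Function.Base using (_∘_)
open import Function.Bundles using (_↔_; Inverse; _⇔_; mk⇔)
import Function.Properties.Equivalence as ⇔
open import Relation.Nullary using (¬_; Dec; yes; no; ¬?; contradiction)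
open import Relation.Binary.Definitions using (DecidableEquality; tri<; tri≈; tri>)
open import Relation.Binary.PropositionalEquality
open import Algebra.Bundles using (CommutativeRing)
open import Algebra.Solver.Ring.AlmostCommutativeRing using (fromCommutativeRing; _-Raw-AlmostCommutative⟶_)
import Algebra.Properties.CommutativeMonoid.Sum
import Algebra.Properties.CommutativeSemiring.Binomial as Binomial

module FieldProperties (K : Field) where
  open Field K public
  open ≡-Reasoning

  commutativeRing : CommutativeRing 0ℓ 0ℓ
  commutativeRing = record { isCommutativeRing = isCommutativeRing }

  open CommutativeRing commutativeRing public
    using ( +-assoc; +-comm; +-identityˡ; +-identityʳ; -‿inverseˡ; -‿inverseʳ
          ; *-assoc; *-comm; *-identityˡ; *-identityʳ; distribˡ; distribʳ; zeroˡ; zeroʳ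
          ; semiring; commutativeSemiring; +-commutativeMonoid; *-commutativeMonoid )
  open import Algebra.Properties.Ring (CommutativeRing.ring commutativeRing) public
    using (-‿involutive; -‿distribˡ-*; -‿distribʳ-*; -0#≈0#; -‿anti-homo-+)
  open import Algebra.Properties.Semiring.Mult semiring using (×-homo-+; ×1-homo-*) renaming (_×_ to _×ₘ_)
  open import Algebra.Properties.Semiring.Exp semiring public using (_^_; ^-homo-*; ^-assocʳ)
  open import Algebra.Properties.CommutativeSemiring.Exp commutativeSemiring public using (^-distrib-*)

  fromℕ : ℕ → Carrier
  fromℕ n = n ×ₘ 1#

  fromℕ-+ : ∀ m n → fromℕ (m ℕ.+ n) ≡ fromℕ m + fromℕ n
  fromℕ-+ = ×-homo-+ 1#

  fromℕ-* : ∀ m n → fromℕ (m ℕ.* n) ≡ fromℕ m * fromℕ n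
  fromℕ-* = ×1-homo-*

  ι : ℤ → Carrier
  ι (ℤ.+ n)  = fromℕ n
  ι -[1+ n ] = - fromℕ (suc n)

  ι-neg : ∀ i → ι (ℤ.- i) ≡ - ι i
  ι-neg (ℤ.+ zero)    = sym -0#≈0#
  ι-neg (ℤ.+ (suc n)) = refl
  ι-neg -[1+ n ]      = sym (-‿involutive _)

  ι-⊖ : ∀ m n → ι (m ℤ.⊖ n) ≡ fromℕ m + - fromℕ n
  ι-⊖ zero    zero    = sym (trans (+-identityˡ _) -0#≈0#)
  ι-⊖ zero    (suc n) = sym (+-identityˡ _)
  ι-⊖ (suc m) zero    = sym (trans (cong (fromℕ (suc m) +_) -0#≈0#) (+-identityʳ _))
  ι-⊖ (suc m) (suc n) = begin
    ι (suc m ℤ.⊖ suc n)                 ≡⟨ cong ι (ℤ.[1+m]⊖[1+n]≡m⊖n m n) ⟩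
    ι (m ℤ.⊖ n)                         ≡⟨ ι-⊖ m n ⟩
    fromℕ m + - fromℕ n                 ≡⟨ cancel (fromℕ m) (fromℕ n) ⟩
    (1# + fromℕ m) + - (1# + fromℕ n)   ∎
    where
    cancel : ∀ a b → a + - b ≡ (1# + a) + - (1# + b)
    cancel a b = sym (begin
      (1# + a) + - (1# + b)            ≡⟨ cong ((1# + a) +_) (-‿anti-homo-+ 1# b) ⟩
      (1# + a) + (- b + - 1#)          ≡⟨ cong (_+ (- b + - 1#)) (+-comm 1# a) ⟩
      (a + 1#) + (- b + - 1#)          ≡⟨ +-assoc a 1# _ ⟩
      a + (1# + (- b + - 1#))          ≡⟨ cong (a +_) (+-comm 1# _) ⟩
      a + ((- b + - 1#) + 1#)          ≡⟨ cong (a +_) (+-assoc (- b) (- 1#) 1#) ⟩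
      a + (- b + (- 1# + 1#))          ≡⟨ cong (λ t → a + (- b + t)) (-‿inverseˡ 1#) ⟩
      a + (- b + 0#)                   ≡⟨ cong (a +_) (+-identityʳ (- b)) ⟩
      a + - b                          ∎)

  ι-+ : ∀ i j → ι (i ℤ.+ j) ≡ ι i + ι j
  ι-+ (ℤ.+ m)  (ℤ.+ n)  = fromℕ-+ m n
  ι-+ (ℤ.+ m)  -[1+ n ] = ι-⊖ m (suc n)
  ι-+ -[1+ m ] (ℤ.+ n)  = trans (ι-⊖ n (suc m)) (+-comm _ _)
  ι-+ -[1+ m ] -[1+ n ] = begin
    - fromℕ (suc (suc m) ℕ.+ n)           ≡⟨ cong -_ (fromℕ-+ (suc (suc m)) n) ⟩
    - (1# + (1# + fromℕ m) + fromℕ n)     ≡⟨ cong -_ (cong (_+ fromℕ n) (+-comm 1# _)) ⟩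
    - ((1# + fromℕ m) + 1# + fromℕ n)     ≡⟨ cong -_ (+-assoc _ 1# _) ⟩
    - ((1# + fromℕ m) + (1# + fromℕ n))   ≡⟨ -‿anti-homo-+ _ _ ⟩
    - (1# + fromℕ n) + - (1# + fromℕ m)   ≡⟨ +-comm _ _ ⟩
    - (1# + fromℕ m) + - (1# + fromℕ n)   ∎

  ι-+* : ∀ m j → ι (ℤ.+ m ℤ.* j) ≡ fromℕ m * ι j
  ι-+* m (ℤ.+ n) = trans (cong ι (sym (ℤ.pos-* m n))) (fromℕ-* m n)
  ι-+* m -[1+ n ] = begin
    ι (ℤ.+ m ℤ.* -[1+ n ])               ≡⟨ cong ι (sym (ℤ.neg-distribʳ-* (ℤ.+ m) (ℤ.+ suc n))) ⟩
    ι (ℤ.- (ℤ.+ m ℤ.* ℤ.+ suc n))        ≡⟨ ι-neg (ℤ.+ m ℤ.* ℤ.+ suc n) ⟩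
    - ι (ℤ.+ m ℤ.* ℤ.+ suc n)            ≡⟨ cong -_ (ι-+* m (ℤ.+ suc n)) ⟩
    - (fromℕ m * fromℕ (suc n))          ≡⟨ -‿distribʳ-* _ _ ⟩
    fromℕ m * - fromℕ (suc n)            ∎

  ι-* : ∀ i j → ι (i ℤ.* j) ≡ ι i * ι j
  ι-* (ℤ.+ m)  j = ι-+* m j
  ι-* -[1+ m ] j = begin
    ι (-[1+ m ] ℤ.* j)                   ≡⟨ cong ι (sym (ℤ.neg-distribˡ-* (ℤ.+ suc m) j)) ⟩
    ι (ℤ.- (ℤ.+ suc m ℤ.* j))            ≡⟨ ι-neg (ℤ.+ suc m ℤ.* j) ⟩
    - ι (ℤ.+ suc m ℤ.* j)                ≡⟨ cong -_ (ι-+* (suc m) j) ⟩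
    - (fromℕ (suc m) * ι j)              ≡⟨ -‿distribˡ-* _ _ ⟩
    - fromℕ (suc m) * ι j                ∎

  -- The solver checks its normal forms by `refl`, so the constants 1 and -1 must denote
  -- 1# and - 1# definitionally; ι itself gives 1# + 0# there.
  fromℤ : ℤ → Carrier
  fromℤ (ℤ.+ 1)    = 1#
  fromℤ -[1+ 0 ]   = - 1#
  fromℤ i          = ι i

  fromℤ≡ι : ∀ i → fromℤ i ≡ ι i
  fromℤ≡ι (ℤ.+ 0)             = refl
  fromℤ≡ι (ℤ.+ 1)             = sym (+-identityʳ 1#)
  fromℤ≡ι (ℤ.+ suc (suc n))   = refl
  fromℤ≡ι -[1+ 0 ]            = cong -_ (sym (+-identityʳ 1#))
  fromℤ≡ι -[1+ suc n ]        = refl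

  ℤ⟶K : ℤ.+-*-rawRing -Raw-AlmostCommutative⟶ fromCommutativeRing commutativeRing
  ℤ⟶K = record
    { ⟦_⟧ = fromℤ ; 0-homo = refl ; 1-homo = refl
    ; +-homo = λ i j → via (ι-+ i j) (cong₂ _+_ (fromℤ≡ι i) (fromℤ≡ι j)) (fromℤ≡ι (i ℤ.+ j))
    ; *-homo = λ i j → via (ι-* i j) (cong₂ _*_ (fromℤ≡ι i) (fromℤ≡ι j)) (fromℤ≡ι (i ℤ.* j))
    ; -‿homo = λ i → via (ι-neg i) (cong -_ (fromℤ≡ι i)) (fromℤ≡ι (ℤ.- i)) }
    where
    via : ∀ {a b a′ b′ : Carrier} → a′ ≡ b′ → b ≡ b′ → a ≡ a′ → a ≡ b
    via a′≡b′ b≡b′ a≡a′ = trans a≡a′ (trans a′≡b′ (sym b≡b′))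

  ℤ-coeff≟ : ∀ i j → Maybe (fromℤ i ≡ fromℤ j)
  ℤ-coeff≟ i j with i ℤ.≟ j
  ... | yes i≡j = just (cong fromℤ i≡j)
  ... | no _    = nothing

  open import Algebra.Solver.Ring ℤ.+-*-rawRing (fromCommutativeRing commutativeRing) ℤ⟶K ℤ-coeff≟ public

  ∑ : ∀ {k} → (Fin k → Carrier) → Carrier
  ∑ = sumFin K

  ∑-cong : ∀ {k} {f g : Fin k → Carrier} → (∀ i → f i ≡ g i) → ∑ f ≡ ∑ g
  ∑-cong {zero}  f≗g = refl
  ∑-cong {suc k} f≗g = cong₂ _+_ (f≗g zero) (∑-cong (f≗g ∘ suc))

  ∑-distrib-+ : ∀ {k} (f g : Fin k → Carrier) → ∑ (λ i → f i + g i) ≡ ∑ f + ∑ g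
  ∑-distrib-+ {zero}  f g = sym (+-identityˡ 0#)
  ∑-distrib-+ {suc k} f g = trans (cong (f zero + g zero +_) (∑-distrib-+ (f ∘ suc) (g ∘ suc)))
    (solve 4 (λ a b c d → a :+ b :+ (c :+ d) := a :+ c :+ (b :+ d)) refl _ _ _ _)

  *-distribˡ-∑ : ∀ {k} a (f : Fin k → Carrier) → ∑ (λ i → a * f i) ≡ a * ∑ f
  *-distribˡ-∑ {zero}  a f = sym (zeroʳ a)
  *-distribˡ-∑ {suc k} a f = trans (cong (a * f zero +_) (*-distribˡ-∑ a (f ∘ suc))) (sym (distribˡ _ _ _))

  -‿distrib-∑ : ∀ {k} (f : Fin k → Carrier) → ∑ (λ i → - f i) ≡ - ∑ f
  -‿distrib-∑ {zero}  f = sym -0#≈0#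
  -‿distrib-∑ {suc k} f = trans (cong (- f zero +_) (-‿distrib-∑ (f ∘ suc)))
    (solve 2 (λ a b → :- a :+ :- b := :- (a :+ b)) refl _ _)

  ∑-zero : ∀ {k} (f : Fin k → Carrier) → (∀ i → f i ≡ 0#) → ∑ f ≡ 0#
  ∑-zero {zero}  f f≗0 = refl
  ∑-zero {suc k} f f≗0 = trans (cong₂ _+_ (f≗0 zero) (∑-zero (f ∘ suc) (f≗0 ∘ suc))) (+-identityˡ 0#)

  ∑-comm : ∀ {k m} (f : Fin k → Fin m → Carrier) → ∑ (λ i → ∑ (f i)) ≡ ∑ (λ j → ∑ (λ i → f i j))
  ∑-comm {zero}  {m} f = sym (∑-zero {m} (λ _ → 0#) (λ _ → refl))
  ∑-comm {suc k} {m} f = trans (cong (∑ (f zero) +_) (∑-comm (f ∘ suc))) (sym (∑-distrib-+ (f zero) _))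

  ∑-single : ∀ {k} (f : Fin k → Carrier) i₀ → (∀ i → i ≢ i₀ → f i ≡ 0#) → ∑ f ≡ f i₀
  ∑-single {suc k} f zero     others = trans (cong (f zero +_) (∑-zero (f ∘ suc) (λ i → others (suc i) (λ ())))) (+-identityʳ _)
  ∑-single {suc k} f (suc i₀) others = trans (cong (_+ ∑ (f ∘ suc)) (others zero (λ ())))
    (trans (+-identityˡ _) (∑-single (f ∘ suc) i₀ (λ i i≢i₀ → others (suc i) (i≢i₀ ∘ Fin.suc-injective))))

  module +-Sum = Algebra.Properties.CommutativeMonoid.Sum +-commutativeMonoid
  module *-Sum = Algebra.Properties.CommutativeMonoid.Sum *-commutativeMonoid

  ∏ : ∀ {k} → (Fin k → Carrier) → Carrier
  ∏ = *-Sum.sum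

  ∑≡sum : ∀ {k} (f : Fin k → Carrier) → ∑ f ≡ +-Sum.sum f
  ∑≡sum {zero}  f = refl
  ∑≡sum {suc k} f = cong (f zero +_) (∑≡sum (f ∘ suc))

  ∑-permute : ∀ {k} (f : Fin k → Carrier) (π ρ : Fin k → Fin k) →
              (∀ i → π (ρ i) ≡ i) → (∀ i → ρ (π i) ≡ i) → ∑ (f ∘ π) ≡ ∑ f
  ∑-permute f π ρ πρ ρπ = trans (∑≡sum (f ∘ π))
    (trans (sym (+-Sum.sum-permute f (permutation π ρ πρ ρπ))) (sym (∑≡sum f)))

  ∏-permute : ∀ {k} (f : Fin k → Carrier) (π ρ : Fin k → Fin k) →
              (∀ i → π (ρ i) ≡ i) → (∀ i → ρ (π i) ≡ i) → ∏ (f ∘ π) ≡ ∏ f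
  ∏-permute f π ρ πρ ρπ = sym (*-Sum.sum-permute f (permutation π ρ πρ ρπ))

  pow≡^ : ∀ x m → pow K x m ≡ x ^ m
  pow≡^ x zero    = refl
  pow≡^ x (suc m) = cong (x *_) (pow≡^ x m)

  pow-* : ∀ x a b → pow K x (a ℕ.* b) ≡ pow K (pow K x a) b
  pow-* x a b = begin
    pow K x (a ℕ.* b)     ≡⟨ pow≡^ x (a ℕ.* b) ⟩
    x ^ (a ℕ.* b)         ≡⟨ sym (^-assocʳ x a b) ⟩
    (x ^ a) ^ b           ≡⟨ sym (trans (pow≡^ _ b) (cong (_^ b) (pow≡^ x a))) ⟩
    pow K (pow K x a) b   ∎

  pow-distrib-* : ∀ x y m → pow K (x * y) m ≡ pow K x m * pow K y m
  pow-distrib-* x y m = begin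
    pow K (x * y) m          ≡⟨ pow≡^ (x * y) m ⟩
    (x * y) ^ m              ≡⟨ ^-distrib-* x y m ⟩
    x ^ m * y ^ m            ≡⟨ sym (cong₂ _*_ (pow≡^ x m) (pow≡^ y m)) ⟩
    pow K x m * pow K y m    ∎

  pow-zero : ∀ m → pow K 0# (suc m) ≡ 0#
  pow-zero m = zeroˡ _

  fromℕ-^ : ∀ a m → fromℕ (a ℕ.^ m) ≡ pow K (fromℕ a) m
  fromℕ-^ a zero    = +-identityʳ 1#
  fromℕ-^ a (suc m) = trans (fromℕ-* a (a ℕ.^ m)) (cong (fromℕ a *_) (fromℕ-^ a m))

  x≢0∧x*y≡0⇒y≡0 : ∀ {x y} → x ≢ 0# → x * y ≡ 0# → y ≡ 0#
  x≢0∧x*y≡0⇒y≡0 {x} {y} x≢0 xy≡0 with inverse x x≢0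
  ... | x⁻¹ , xx⁻¹≡1 = begin
    y                  ≡⟨ sym (*-identityˡ y) ⟩
    1# * y             ≡⟨ cong (_* y) (sym xx⁻¹≡1) ⟩
    x * x⁻¹ * y        ≡⟨ solve 3 (λ x x⁻¹ y → x :* x⁻¹ :* y := x⁻¹ :* (x :* y)) refl x x⁻¹ y ⟩
    x⁻¹ * (x * y)      ≡⟨ cong (x⁻¹ *_) xy≡0 ⟩
    x⁻¹ * 0#           ≡⟨ zeroʳ x⁻¹ ⟩
    0#                 ∎

  x≢0∧y≢0⇒x*y≢0 : ∀ {x y} → x ≢ 0# → y ≢ 0# → x * y ≢ 0#
  x≢0∧y≢0⇒x*y≢0 x≢0 y≢0 xy≡0 = y≢0 (x≢0∧x*y≡0⇒y≡0 x≢0 xy≡0)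

  pow-≢0 : ∀ {x} m → x ≢ 0# → pow K x m ≢ 0#
  pow-≢0 zero    x≢0 1≡0 = 0≢1 (sym 1≡0)
  pow-≢0 (suc m) x≢0     = x≢0∧y≢0⇒x*y≢0 x≢0 (pow-≢0 m x≢0)

  x+y≡x⇒y≡0 : ∀ {x y} → x + y ≡ x → y ≡ 0#
  x+y≡x⇒y≡0 {x} {y} x+y≡x = begin
    y                ≡⟨ solve 2 (λ x y → y := x :+ y :+ :- x) refl x y ⟩
    x + y + - x      ≡⟨ cong (_+ - x) x+y≡x ⟩
    x + - x          ≡⟨ -‿inverseʳ x ⟩
    0#               ∎

  x*y≡y⇒x≡1 : ∀ {x y} → y ≢ 0# → x * y ≡ y → x ≡ 1#
  x*y≡y⇒x≡1 {x} {y} y≢0 xy≡y = begin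
    x                ≡⟨ solve 1 (λ x → x := x :+ :- con (ℤ.+ 1) :+ con (ℤ.+ 1)) refl x ⟩
    x + - 1# + 1#    ≡⟨ cong (_+ 1#) (x≢0∧x*y≡0⇒y≡0 y≢0 y[x-1]≡0) ⟩
    0# + 1#          ≡⟨ +-identityˡ 1# ⟩
    1#               ∎
    where
    y[x-1]≡0 : y * (x + - 1#) ≡ 0#
    y[x-1]≡0 = begin
      y * (x + - 1#)   ≡⟨ solve 2 (λ x y → y :* (x :+ :- con (ℤ.+ 1)) := x :* y :+ :- y) refl x y ⟩
      x * y + - y      ≡⟨ cong (_+ - y) xy≡y ⟩
      y + - y          ≡⟨ -‿inverseʳ y ⟩
      0#               ∎

  ∑-one : ∀ k → ∑ {k} (λ _ → 1#) ≡ fromℕ k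
  ∑-one k = trans (∑≡sum {k} (λ _ → 1#)) (+-Sum.sum-replicate k)

  ∏-const : ∀ k a → ∏ {k} (λ _ → a) ≡ pow K a k
  ∏-const zero    a = refl
  ∏-const (suc k) a = cong (a *_) (∏-const k a)

  ∏-≢0 : ∀ {k} (f : Fin k → Carrier) → (∀ i → f i ≢ 0#) → ∏ f ≢ 0#
  ∏-≢0 {zero}  f f≢0 1≡0 = 0≢1 (sym 1≡0)
  ∏-≢0 {suc k} f f≢0     = x≢0∧y≢0⇒x*y≢0 (f≢0 zero) (∏-≢0 (f ∘ suc) (f≢0 ∘ suc))

  ∏-except : ∀ {k} (f : Fin k → Carrier) i₀ a → (∀ i → i ≢ i₀ → f i ≡ a) → f i₀ ≡ 1# →
             ∏ f * a ≡ pow K a k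
  ∏-except {suc k} f zero a others fi₀≡1 = begin
    f zero * ∏ (f ∘ suc) * a      ≡⟨ cong (λ t → t * ∏ (f ∘ suc) * a) fi₀≡1 ⟩
    1# * ∏ (f ∘ suc) * a          ≡⟨ cong (_* a) (*-identityˡ _) ⟩
    ∏ (f ∘ suc) * a               ≡⟨ cong (_* a) (trans (*-Sum.sum-cong-≗ (λ i → others (suc i) (λ ()))) (∏-const k a)) ⟩
    pow K a k * a                 ≡⟨ *-comm _ a ⟩
    pow K a (suc k)               ∎
  ∏-except {suc k} f (suc i₀) a others fi₀≡1 = begin
    f zero * ∏ (f ∘ suc) * a      ≡⟨ *-assoc _ _ _ ⟩
    f zero * (∏ (f ∘ suc) * a)    ≡⟨ cong₂ _*_ (others zero (λ ()))
                                      (∏-except (f ∘ suc) i₀ a (λ i i≢i₀ → others (suc i) (i≢i₀ ∘ Fin.suc-injective)) fi₀≡1) ⟩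
    pow K a (suc k)               ∎

  sign : ℕ → Carrier → Carrier
  sign zero          a = a
  sign (suc zero)    a = - a
  sign (suc (suc m)) a = sign m a

  sign-suc : ∀ m a → sign (suc m) a ≡ - sign m a
  sign-suc zero          a = refl
  sign-suc (suc zero)    a = sym (-‿involutive a)
  sign-suc (suc (suc m)) a = sign-suc m a

  sign-neg : ∀ m a → sign m (- a) ≡ - sign m a
  sign-neg zero          a = refl
  sign-neg (suc zero)    a = refl
  sign-neg (suc (suc m)) a = sign-neg m a

  sign-+ : ∀ m a b → sign m (a + b) ≡ sign m a + sign m b
  sign-+ zero          a b = refl
  sign-+ (suc zero)    a b = solve 2 (λ a b → :- (a :+ b) := :- a :+ :- b) refl a b
  sign-+ (suc (suc m)) a b = sign-+ m a b

  sign-* : ∀ m a b → sign m (a * b) ≡ a * sign m b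
  sign-* zero          a b = refl
  sign-* (suc zero)    a b = -‿distribʳ-* a b
  sign-* (suc (suc m)) a b = sign-* m a b

  sign-0 : ∀ m → sign m 0# ≡ 0#
  sign-0 zero          = refl
  sign-0 (suc zero)    = -0#≈0#
  sign-0 (suc (suc m)) = sign-0 m

  sign-∑ : ∀ m {t} (f : Fin t → Carrier) → sign m (∑ f) ≡ ∑ (λ i → sign m (f i))
  sign-∑ m {zero}  f = sign-0 m
  sign-∑ m {suc t} f = trans (sign-+ m _ _) (cong (sign m (f zero) +_) (sign-∑ m (f ∘ suc)))

  sign-suc-suc : ∀ a b x → sign (suc a) (sign (suc b) x) ≡ sign a (sign b x)
  sign-suc-suc a b x = trans (sign-suc a _) (trans (cong -_ (trans (cong (sign a) (sign-suc b x)) (sign-neg a _))) (-‿involutive _))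

  x+y≡0⇒x≡-y : ∀ {x y} → x + y ≡ 0# → x ≡ - y
  x+y≡0⇒x≡-y {x} {y} x+y≡0 = begin
    x                ≡⟨ solve 2 (λ x y → x := x :+ y :+ :- y) refl x y ⟩
    x + y + - y      ≡⟨ cong (_+ - y) x+y≡0 ⟩
    0# + - y         ≡⟨ +-identityˡ _ ⟩
    - y              ∎

  at-toℕ : ∀ {m} (v : Fin m → Carrier) i → at K v (toℕ i) ≡ v i
  at-toℕ v zero    = refl
  at-toℕ v (suc i) = at-toℕ (v ∘ suc) i

module PolynomialProperties (K : Field) where
  open FieldProperties K
  open ≡-Reasoning

  eval : Poly K → Carrier → Carrier
  eval []      x = 0#
  eval (c ∷ p) x = c + x * eval p x

  eval-addP : ∀ p r x → eval (addP K p r) x ≡ eval p x + eval r x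
  eval-addP []      r       x = sym (+-identityˡ _)
  eval-addP (c ∷ p) []      x = sym (+-identityʳ _)
  eval-addP (c ∷ p) (d ∷ r) x = trans (cong (λ t → c + d + x * t) (eval-addP p r x))
    (solve 5 (λ c d x a b → c :+ d :+ x :* (a :+ b) := c :+ x :* a :+ (d :+ x :* b)) refl c d x (eval p x) (eval r x))

  eval-negP : ∀ p x → eval (negP K p) x ≡ - eval p x
  eval-negP []      x = sym -0#≈0#
  eval-negP (c ∷ p) x = trans (cong (λ t → - c + x * t) (eval-negP p x))
    (solve 3 (λ c x a → :- c :+ x :* (:- a) := :- (c :+ x :* a)) refl c x (eval p x))

  eval-subP : ∀ p r x → eval (subP K p r) x ≡ eval p x + - eval r x
  eval-subP p r x = trans (eval-addP p (negP K r) x) (cong (eval p x +_) (eval-negP r x))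

  eval-scaleP : ∀ a p x → eval (scaleP K a p) x ≡ a * eval p x
  eval-scaleP a []      x = sym (zeroʳ a)
  eval-scaleP a (c ∷ p) x = trans (cong (λ t → a * c + x * t) (eval-scaleP a p x))
    (solve 4 (λ a c x e → a :* c :+ x :* (a :* e) := a :* (c :+ x :* e)) refl a c x (eval p x))

  eval-mulP : ∀ p r x → eval (mulP K p r) x ≡ eval p x * eval r x
  eval-mulP []      r x = sym (zeroˡ _)
  eval-mulP (c ∷ p) r x = begin
    eval (addP K (scaleP K c r) (0# ∷ mulP K p r)) x        ≡⟨ eval-addP (scaleP K c r) (0# ∷ mulP K p r) x ⟩
    eval (scaleP K c r) x + (0# + x * eval (mulP K p r) x)  ≡⟨ cong₂ (λ s t → s + (0# + x * t)) (eval-scaleP c r x) (eval-mulP p r x) ⟩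
    c * eval r x + (0# + x * (eval p x * eval r x))
      ≡⟨ solve 4 (λ c x a b → c :* b :+ (con (ℤ.+ 0) :+ x :* (a :* b)) := (c :+ x :* a) :* b) refl c x (eval p x) (eval r x) ⟩
    (c + x * eval p x) * eval r x                           ∎

  eval-X : ∀ x → eval (X K) x ≡ x
  eval-X = solve 1 (λ x → con (ℤ.+ 0) :+ x :* (con (ℤ.+ 1) :+ x :* con (ℤ.+ 0)) := x) refl

  eval-powP : ∀ p m x → eval (powP K p m) x ≡ pow K (eval p x) m
  eval-powP p zero    x = trans (cong (1# +_) (zeroʳ x)) (+-identityʳ 1#)
  eval-powP p (suc m) x = trans (eval-mulP p (powP K p m) x) (cong (eval p x *_) (eval-powP p m x))

  eval-powP-X : ∀ m x → eval (powP K (X K) m) x ≡ pow K x m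
  eval-powP-X m x = trans (eval-powP (X K) m x) (cong (λ t → pow K t m) (eval-X x))

  eval-sumFinP : ∀ {t} (f : Fin t → Poly K) x → eval (sumFinP K f) x ≡ ∑ (λ i → eval (f i) x)
  eval-sumFinP {zero}  f x = refl
  eval-sumFinP {suc t} f x = trans (eval-addP (f zero) _ x) (cong (eval (f zero) x +_) (eval-sumFinP (f ∘ suc) x))

  eval-signP : ∀ m p x → eval (signP K m p) x ≡ sign m (eval p x)
  eval-signP zero          p x = refl
  eval-signP (suc zero)    p x = eval-negP p x
  eval-signP (suc (suc m)) p x = eval-signP m p x

  coeff-addP : ∀ p r k → coeff K (addP K p r) k ≡ coeff K p k + coeff K r k
  coeff-addP []      r       k       = sym (+-identityˡ _)
  coeff-addP (c ∷ p) []      k       = sym (+-identityʳ _)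
  coeff-addP (c ∷ p) (d ∷ r) zero    = refl
  coeff-addP (c ∷ p) (d ∷ r) (suc k) = coeff-addP p r k

  coeff-negP : ∀ p k → coeff K (negP K p) k ≡ - coeff K p k
  coeff-negP []      k       = sym -0#≈0#
  coeff-negP (c ∷ p) zero    = refl
  coeff-negP (c ∷ p) (suc k) = coeff-negP p k

  coeff-subP : ∀ p r k → coeff K (subP K p r) k ≡ coeff K p k + - coeff K r k
  coeff-subP p r k = trans (coeff-addP p (negP K r) k) (cong (coeff K p k +_) (coeff-negP r k))

  coeff-scaleP : ∀ a p k → coeff K (scaleP K a p) k ≡ a * coeff K p k
  coeff-scaleP a []      k       = sym (zeroʳ a)
  coeff-scaleP a (c ∷ p) zero    = refl
  coeff-scaleP a (c ∷ p) (suc k) = coeff-scaleP a p k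

  coeff-sumFinP : ∀ {t} (f : Fin t → Poly K) k → coeff K (sumFinP K f) k ≡ ∑ (λ i → coeff K (f i) k)
  coeff-sumFinP {zero}  f k = refl
  coeff-sumFinP {suc t} f k = trans (coeff-addP (f zero) _ k) (cong (coeff K (f zero) k +_) (coeff-sumFinP (f ∘ suc) k))

  eval-zeroPoly : ∀ p x → IsZeroPoly K p → eval p x ≡ 0#
  eval-zeroPoly []      x p≈0 = refl
  eval-zeroPoly (c ∷ p) x p≈0 = trans (cong₂ (λ s t → s + x * t) (p≈0 zero) (eval-zeroPoly p x (p≈0 ∘ suc)))
    (trans (cong (0# +_) (zeroʳ x)) (+-identityˡ 0#))

  eval-cong : ∀ p r x → _≈P_ K p r → eval p x ≡ eval r x
  eval-cong []      r       x p≈r = sym (eval-zeroPoly r x (sym ∘ p≈r))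
  eval-cong (c ∷ p) []      x p≈r = eval-zeroPoly (c ∷ p) x p≈r
  eval-cong (c ∷ p) (d ∷ r) x p≈r = cong₂ (λ s t → s + x * t) (p≈r zero) (eval-cong p r x (p≈r ∘ suc))

  coeff-mulP-∷ : ∀ c p r k → coeff K (mulP K (c ∷ p) r) k ≡ c * coeff K r k + coeff K (0# ∷ mulP K p r) k
  coeff-mulP-∷ c p r k = trans (coeff-addP (scaleP K c r) _ k) (cong (_+ coeff K (0# ∷ mulP K p r) k) (coeff-scaleP c r k))

  mulP-zeroʳ : ∀ p r → IsZeroPoly K r → IsZeroPoly K (mulP K p r)
  mulP-zeroʳ []      r r≈0 k = refl
  mulP-zeroʳ (c ∷ p) r r≈0 k = trans (coeff-mulP-∷ c p r k) (trans (cong₂ _+_ (trans (cong (c *_) (r≈0 k)) (zeroʳ c)) (shifted k)) (+-identityˡ 0#))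
    where
    shifted : IsZeroPoly K (0# ∷ mulP K p r)
    shifted zero    = refl
    shifted (suc k) = mulP-zeroʳ p r r≈0 k

  coeff-mulP-addPʳ : ∀ p r s k → coeff K (mulP K p (addP K r s)) k ≡ coeff K (mulP K p r) k + coeff K (mulP K p s) k
  coeff-mulP-addPʳ []      r s k = sym (+-identityˡ 0#)
  coeff-mulP-addPʳ (c ∷ p) r s k = begin
    coeff K (mulP K (c ∷ p) (addP K r s)) k
      ≡⟨ coeff-mulP-∷ c p _ k ⟩
    c * coeff K (addP K r s) k + coeff K (0# ∷ mulP K p (addP K r s)) k
      ≡⟨ cong₂ _+_ (cong (c *_) (coeff-addP r s k)) (shifted k) ⟩
    c * (coeff K r k + coeff K s k) + (coeff K (0# ∷ mulP K p r) k + coeff K (0# ∷ mulP K p s) k)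
      ≡⟨ solve 5 (λ c a b u v → c :* (a :+ b) :+ (u :+ v) := c :* a :+ u :+ (c :* b :+ v)) refl c _ _ _ _ ⟩
    (c * coeff K r k + coeff K (0# ∷ mulP K p r) k) + (c * coeff K s k + coeff K (0# ∷ mulP K p s) k)
      ≡⟨ sym (cong₂ _+_ (coeff-mulP-∷ c p r k) (coeff-mulP-∷ c p s k)) ⟩
    coeff K (mulP K (c ∷ p) r) k + coeff K (mulP K (c ∷ p) s) k
      ∎
    where
    shifted : ∀ k → coeff K (0# ∷ mulP K p (addP K r s)) k ≡ coeff K (0# ∷ mulP K p r) k + coeff K (0# ∷ mulP K p s) k
    shifted zero    = sym (+-identityˡ 0#)
    shifted (suc k) = coeff-mulP-addPʳ p r s k

  coeff-mulP-shiftʳ : ∀ p r k → coeff K (mulP K p (0# ∷ r)) k ≡ coeff K (0# ∷ mulP K p r) k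
  coeff-mulP-shiftʳ []      r zero    = refl
  coeff-mulP-shiftʳ []      r (suc k) = refl
  coeff-mulP-shiftʳ (c ∷ p) r zero    = trans (coeff-mulP-∷ c p (0# ∷ r) zero) (trans (cong (_+ 0#) (zeroʳ c)) (+-identityˡ 0#))
  coeff-mulP-shiftʳ (c ∷ p) r (suc k) = trans (coeff-mulP-∷ c p (0# ∷ r) (suc k))
    (trans (cong (c * coeff K r k +_) (coeff-mulP-shiftʳ p r k)) (sym (coeff-mulP-∷ c p r k)))

  coeff-mulP-constPʳ : ∀ p d k → coeff K (mulP K p (constP K d)) k ≡ d * coeff K p k
  coeff-mulP-constPʳ []      d k       = sym (zeroʳ d)
  coeff-mulP-constPʳ (c ∷ p) d zero    = trans (coeff-mulP-∷ c p (constP K d) zero) (trans (+-identityʳ _) (*-comm c d))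
  coeff-mulP-constPʳ (c ∷ p) d (suc k) = trans (coeff-mulP-∷ c p (constP K d) (suc k))
    (trans (cong₂ _+_ (zeroʳ c) (coeff-mulP-constPʳ p d k)) (+-identityˡ _))

  coeff-constP-suc : ∀ c k → coeff K (constP K c) (suc k) ≡ 0#
  coeff-constP-suc c zero    = refl
  coeff-constP-suc c (suc k) = refl

  constP-0#≈0 : IsZeroPoly K (constP K 0#)
  constP-0#≈0 zero    = refl
  constP-0#≈0 (suc k) = coeff-constP-suc 0# k

  coeff-X*-suc : ∀ r k → coeff K (mulP K (X K) r) (suc k) ≡ coeff K r k
  coeff-X*-suc r k = begin
    coeff K (mulP K (X K) r) (suc k)                          ≡⟨ coeff-mulP-∷ 0# (1# ∷ []) r (suc k) ⟩
    0# * coeff K r (suc k) + coeff K (mulP K (oneP K) r) k    ≡⟨ cong₂ _+_ (zeroˡ _) (coeff-mulP-∷ 1# [] r k) ⟩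
    0# + (1# * coeff K r k + coeff K (constP K 0#) k)         ≡⟨ cong (λ t → 0# + (1# * coeff K r k + t)) (constP-0#≈0 k) ⟩
    0# + (1# * coeff K r k + 0#)                              ≡⟨ solve 1 (λ a → con (ℤ.+ 0) :+ (con (ℤ.+ 1) :* a :+ con (ℤ.+ 0)) := a) refl (coeff K r k) ⟩
    coeff K r k                                               ∎

  coeff-X*-zero : ∀ r → coeff K (mulP K (X K) r) zero ≡ 0#
  coeff-X*-zero r = trans (coeff-mulP-∷ 0# (1# ∷ []) r zero) (trans (cong (_+ 0#) (zeroˡ _)) (+-identityˡ 0#))

  coeff-powP-X-≡ : ∀ m → coeff K (powP K (X K) m) m ≡ 1#
  coeff-powP-X-≡ zero    = refl
  coeff-powP-X-≡ (suc m) = trans (coeff-X*-suc (powP K (X K) m) m) (coeff-powP-X-≡ m)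

  coeff-powP-X-≢ : ∀ m j → j ≢ m → coeff K (powP K (X K) m) j ≡ 0#
  coeff-powP-X-≢ zero    zero    j≢m = ⊥-elim (j≢m refl)
  coeff-powP-X-≢ zero    (suc j) j≢m = refl
  coeff-powP-X-≢ (suc m) zero    j≢m = coeff-X*-zero (powP K (X K) m)
  coeff-powP-X-≢ (suc m) (suc j) j≢m = trans (coeff-X*-suc (powP K (X K) m) j) (coeff-powP-X-≢ m j (j≢m ∘ cong suc))

  coeff-X-≥2 : ∀ k → 2 ℕ.≤ k → coeff K (X K) k ≡ 0#
  coeff-X-≥2 (suc (suc k)) _         = refl
  coeff-X-≥2 (suc zero)    (s≤s ())

  linearP : Carrier → Poly K
  linearP a = (- a) ∷ 1# ∷ []

  eval-linearP : ∀ a x → eval (linearP a) x ≡ x + - a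
  eval-linearP = solve 2 (λ a x → :- a :+ x :* (con (ℤ.+ 1) :+ x :* con (ℤ.+ 0)) := x :+ :- a) refl

  coeff-linearP*-zero : ∀ a S → coeff K (mulP K (linearP a) S) zero ≡ - a * coeff K S zero
  coeff-linearP*-zero a S = trans (coeff-mulP-∷ (- a) (1# ∷ []) S zero) (+-identityʳ _)

  coeff-linearP*-suc : ∀ a S j → coeff K (mulP K (linearP a) S) (suc j) ≡ - a * coeff K S (suc j) + coeff K S j
  coeff-linearP*-suc a S j = trans (coeff-mulP-∷ (- a) (1# ∷ []) S (suc j))
    (cong (- a * coeff K S (suc j) +_) (trans (coeff-mulP-∷ 1# [] S j)
      (trans (cong (1# * coeff K S j +_) (constP-0#≈0 j)) (trans (+-identityʳ _) (*-identityˡ _)))))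

  -- Synthetic division (Horner): the quotient of R by x - a, whose remainder is R(a).
  divLinear : Poly K → Carrier → Poly K
  divLinear []      a = []
  divLinear (c ∷ p) a = eval p a ∷ divLinear p a

  divLinear-spec : ∀ R a k → coeff K R k ≡ coeff K (mulP K (linearP a) (divLinear R a)) k + coeff K (constP K (eval R a)) k
  divLinear-spec []      a zero    = sym (trans (cong (_+ 0#) (coeff-linearP*-zero a []))
    (solve 1 (λ a → :- a :* con (ℤ.+ 0) :+ con (ℤ.+ 0) := con (ℤ.+ 0)) refl a))
  divLinear-spec []      a (suc k) = sym (trans (cong (_+ coeff K (constP K 0#) (suc k)) (coeff-linearP*-suc a [] k))
    (trans (cong₂ _+_ (cong (_+ coeff K [] k) (zeroʳ (- a))) (coeff-constP-suc 0# k)) (trans (+-identityʳ _) (+-identityʳ _))))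
  divLinear-spec (c ∷ R) a zero    = sym (trans (cong (_+ (c + a * eval R a)) (coeff-linearP*-zero a (eval R a ∷ divLinear R a)))
    (solve 3 (λ a c e → :- a :* e :+ (c :+ a :* e) := c) refl a c (eval R a)))
  divLinear-spec (c ∷ R) a (suc zero) = trans (divLinear-spec R a zero)
    (trans (cong (_+ eval R a) (coeff-linearP*-zero a (divLinear R a)))
      (sym (trans (cong (_+ 0#) (coeff-linearP*-suc a (eval R a ∷ divLinear R a) zero)) (+-identityʳ _))))
  divLinear-spec (c ∷ R) a (suc (suc j)) = trans (divLinear-spec R a (suc j))
    (trans (cong (_+ coeff K (constP K (eval R a)) (suc j)) (coeff-linearP*-suc a (divLinear R a) j))
      (sym (cong₂ _+_ (coeff-linearP*-suc a (eval R a ∷ divLinear R a) (suc j)) (coeff-constP-suc (eval (c ∷ R) a) j))))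

  divLinear-zero : ∀ R a → IsZeroPoly K R → IsZeroPoly K (divLinear R a)
  divLinear-zero []      a R≈0 k       = refl
  divLinear-zero (c ∷ R) a R≈0 zero    = eval-zeroPoly R a (R≈0 ∘ suc)
  divLinear-zero (c ∷ R) a R≈0 (suc k) = divLinear-zero R a (R≈0 ∘ suc) k

  divLinear-degLt : ∀ R a m → DegLt K R (suc m) → DegLt K (divLinear R a) m
  divLinear-degLt []      a m       deg k       _         = refl
  divLinear-degLt (c ∷ R) a zero    deg zero    _         = eval-zeroPoly R a (λ j → deg (suc j) (s≤s z≤n))
  divLinear-degLt (c ∷ R) a zero    deg (suc k) _         = divLinear-zero R a (λ j → deg (suc j) (s≤s z≤n)) k
  divLinear-degLt (c ∷ R) a (suc m) deg (suc k) (s≤s m≤k) = divLinear-degLt R a m (λ j → deg (suc j) ∘ s≤s) k m≤k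

  eval-divLinear : ∀ R a x → eval R x ≡ (x + - a) * eval (divLinear R a) x + eval R a
  eval-divLinear R a x = begin
    eval R x                                            ≡⟨ eval-cong R (addP K Q (constP K (eval R a))) x R≈ ⟩
    eval (addP K Q (constP K (eval R a))) x             ≡⟨ eval-addP Q (constP K (eval R a)) x ⟩
    eval Q x + (eval R a + x * 0#)                      ≡⟨ cong₂ _+_ (trans (eval-mulP (linearP a) (divLinear R a) x)
                                                                            (cong (_* eval (divLinear R a) x) (eval-linearP a x)))
                                                                     (trans (cong (eval R a +_) (zeroʳ x)) (+-identityʳ _)) ⟩
    (x + - a) * eval (divLinear R a) x + eval R a       ∎
    where
    Q = mulP K (linearP a) (divLinear R a)
    R≈ : _≈P_ K R (addP K Q (constP K (eval R a)))
    R≈ k = trans (divLinear-spec R a k) (sym (coeff-addP Q (constP K (eval R a)) k))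

  -- Peel off the root pts 0 and recurse on the quotient, which vanishes at the remaining points.
  degLt-roots⇒zero : ∀ m (pts : Fin m → Carrier) → (∀ i j → pts i ≡ pts j → i ≡ j) →
                     ∀ R → DegLt K R m → (∀ i → eval R (pts i) ≡ 0#) → IsZeroPoly K R
  degLt-roots⇒zero zero    pts inj R deg roots k = deg k z≤n
  degLt-roots⇒zero (suc m) pts inj R deg roots k = begin
    coeff K R k                                                        ≡⟨ divLinear-spec R a k ⟩
    coeff K (mulP K (linearP a) Q) k + coeff K (constP K (eval R a)) k ≡⟨ cong₂ _+_ (mulP-zeroʳ (linearP a) Q Q≈0 k) (remainder k) ⟩
    0# + 0#                                                            ≡⟨ +-identityˡ 0# ⟩
    0#                                                                 ∎
    where
    a = pts zero
    Q = divLinear R a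
    Q-roots : ∀ i → eval Q (pts (suc i)) ≡ 0#
    Q-roots i = x≢0∧x*y≡0⇒y≡0 x-a≢0 (begin
      (x + - a) * eval Q x             ≡⟨ sym (+-identityʳ _) ⟩
      (x + - a) * eval Q x + 0#        ≡⟨ cong ((x + - a) * eval Q x +_) (sym (roots zero)) ⟩
      (x + - a) * eval Q x + eval R a  ≡⟨ sym (eval-divLinear R a x) ⟩
      eval R x                         ≡⟨ roots (suc i) ⟩
      0#                               ∎)
      where
      x = pts (suc i)
      x-a≢0 : x + - a ≢ 0#
      x-a≢0 x-a≡0 with inj (suc i) zero (trans (solve 2 (λ x a → x := x :+ :- a :+ a) refl x a)
                                          (trans (cong (_+ a) x-a≡0) (+-identityˡ a)))
      ... | ()
    Q≈0 : IsZeroPoly K Q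
    Q≈0 = degLt-roots⇒zero m (pts ∘ suc) (λ i j eq → Fin.suc-injective (inj (suc i) (suc j) eq)) Q (divLinear-degLt R a m deg) Q-roots
    remainder : IsZeroPoly K (constP K (eval R a))
    remainder zero    = roots zero
    remainder (suc k) = coeff-constP-suc (eval R a) k

  module _ (M₁ : ℕ) (1≤M₁ : 1 ℕ.≤ M₁) where

    private
      M = suc M₁

    xᴹ-x : Poly K
    xᴹ-x = subP K (powP K (X K) M) (X K)

    coeff-xᴹ-x-M : coeff K xᴹ-x M ≡ 1#
    coeff-xᴹ-x-M = trans (coeff-subP (powP K (X K) M) (X K) M)
      (trans (cong₂ (λ s t → s + - t) (coeff-powP-X-≡ M) (coeff-X-≥2 M (s≤s 1≤M₁)))
        (trans (cong (1# +_) -0#≈0#) (+-identityʳ 1#)))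

    coeff-xᴹ-x->M : ∀ k → M ℕ.< k → coeff K xᴹ-x k ≡ 0#
    coeff-xᴹ-x->M k M<k = trans (coeff-subP (powP K (X K) M) (X K) k)
      (trans (cong₂ (λ s t → s + - t) (coeff-powP-X-≢ M k (λ k≡M → ℕ.<-irrefl (sym k≡M) M<k))
                                      (coeff-X-≥2 k (ℕ.≤-trans (s≤s 1≤M₁) (ℕ.<⇒≤ M<k))))
        (trans (cong (0# +_) -0#≈0#) (+-identityʳ 0#)))

    -- Long division, one coefficient at a time from the top: the quotient of c ∷ P′ is
    -- x·Q′ + d and the remainder is (c ∷ R′) - d·(x^M - x), with d the top coefficient of R′.
    divMod-xᴹ-x : ∀ P → Σ (Poly K) λ Q → Σ (Poly K) λ R →
                  (∀ k → coeff K P k ≡ coeff K (mulP K xᴹ-x Q) k + coeff K R k) × DegLt K R M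
    divMod-xᴹ-x []       = [] , [] , (λ k → sym (trans (+-identityʳ _) (mulP-zeroʳ xᴹ-x [] (λ _ → refl) k))) , (λ _ _ → refl)
    divMod-xᴹ-x (c ∷ P′) with divMod-xᴹ-x P′
    ... | Q′ , R′ , P′≈ , degR′ = Q , R , P≈ , degR
      where
      d = coeff K R′ M₁
      Q = addP K (0# ∷ Q′) (constP K d)
      R = subP K (c ∷ R′) (scaleP K d xᴹ-x)
      shifted : ∀ k → coeff K (c ∷ P′) k ≡ coeff K (0# ∷ mulP K xᴹ-x Q′) k + coeff K (c ∷ R′) k
      shifted zero    = sym (+-identityˡ c)
      shifted (suc j) = P′≈ j
      P≈ : ∀ k → coeff K (c ∷ P′) k ≡ coeff K (mulP K xᴹ-x Q) k + coeff K R k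
      P≈ k = trans (shifted k) (sym (begin
        coeff K (mulP K xᴹ-x Q) k + coeff K R k
          ≡⟨ cong₂ _+_ (trans (coeff-mulP-addPʳ xᴹ-x (0# ∷ Q′) (constP K d) k)
                              (cong₂ _+_ (coeff-mulP-shiftʳ xᴹ-x Q′ k) (coeff-mulP-constPʳ xᴹ-x d k)))
                       (trans (coeff-subP (c ∷ R′) (scaleP K d xᴹ-x) k) (cong (λ t → coeff K (c ∷ R′) k + - t) (coeff-scaleP d xᴹ-x k))) ⟩
        (coeff K (0# ∷ mulP K xᴹ-x Q′) k + d * coeff K xᴹ-x k) + (coeff K (c ∷ R′) k + - (d * coeff K xᴹ-x k))
          ≡⟨ solve 3 (λ a b c → a :+ b :+ (c :+ :- b) := a :+ c) refl _ (d * coeff K xᴹ-x k) _ ⟩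
        coeff K (0# ∷ mulP K xᴹ-x Q′) k + coeff K (c ∷ R′) k
          ∎))
      coeff-R : ∀ k → coeff K R k ≡ coeff K (c ∷ R′) k + - (d * coeff K xᴹ-x k)
      coeff-R k = trans (coeff-subP (c ∷ R′) (scaleP K d xᴹ-x) k) (cong (λ t → coeff K (c ∷ R′) k + - t) (coeff-scaleP d xᴹ-x k))
      degR : DegLt K R M
      degR (suc j) (s≤s M₁≤j) with ℕ.≤⇒≤′ M₁≤j
      ... | ℕ.≤′-refl = trans (coeff-R M)
        (trans (cong (λ t → d + - (d * t)) coeff-xᴹ-x-M) (trans (cong (λ t → d + - t) (*-identityʳ d)) (-‿inverseʳ d)))
      ... | ℕ.≤′-step {n = j′} M₁≤j′ = trans (coeff-R (suc (suc j′)))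
        (trans (cong₂ (λ s t → s + - (d * t)) (degR′ (suc j′) (s≤s (ℕ.≤′⇒≤ M₁≤j′))) (coeff-xᴹ-x->M (suc (suc j′)) (s≤s (s≤s (ℕ.≤′⇒≤ M₁≤j′)))))
          (solve 1 (λ d → con (ℤ.+ 0) :+ :- (d :* con (ℤ.+ 0)) := con (ℤ.+ 0)) refl d))

  xᴹ-x∣⇔vanishes : ∀ M → 2 ℕ.≤ M → (pts : Fin M → Carrier) → (∀ i j → pts i ≡ pts j → i ≡ j) →
                   (∀ z → pow K z M ≡ z) → ∀ P →
                   _∣P_ K (subP K (powP K (X K) M) (X K)) P ⇔ (∀ z → eval P z ≡ 0#)
  xᴹ-x∣⇔vanishes (suc M₁) (s≤s 1≤M₁) pts inj fermat P = mk⇔ ∣⇒vanishes vanishes⇒∣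
    where
    F = xᴹ-x M₁ 1≤M₁
    eval-F : ∀ z → eval F z ≡ 0#
    eval-F z = trans (eval-subP (powP K (X K) (suc M₁)) (X K) z)
      (trans (cong₂ (λ s t → s + - t) (trans (eval-powP-X (suc M₁) z) (fermat z)) (eval-X z)) (-‿inverseʳ z))
    ∣⇒vanishes : _∣P_ K F P → ∀ z → eval P z ≡ 0#
    ∣⇒vanishes (Q , P≈FQ) z = trans (eval-cong P (mulP K F Q) z P≈FQ)
      (trans (eval-mulP F Q z) (trans (cong (_* eval Q z) (eval-F z)) (zeroˡ _)))
    vanishes⇒∣ : (∀ z → eval P z ≡ 0#) → _∣P_ K F P
    vanishes⇒∣ P-roots with divMod-xᴹ-x M₁ 1≤M₁ P
    ... | Q , R , P≈ , degR = Q , λ k → trans (P≈ k) (trans (cong (coeff K (mulP K F Q) k +_) (R≈0 k)) (+-identityʳ _))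
      where
      R-roots : ∀ i → eval R (pts i) ≡ 0#
      R-roots i = begin
        eval R (pts i)                                  ≡⟨ sym (+-identityˡ _) ⟩
        0# + eval R (pts i)                             ≡⟨ cong (_+ eval R (pts i)) (sym (trans (cong (_* eval Q (pts i)) (eval-F (pts i))) (zeroˡ _))) ⟩
        eval F (pts i) * eval Q (pts i) + eval R (pts i) ≡⟨ cong (_+ eval R (pts i)) (sym (eval-mulP F Q (pts i))) ⟩
        eval (mulP K F Q) (pts i) + eval R (pts i)      ≡⟨ sym (eval-addP (mulP K F Q) R (pts i)) ⟩
        eval (addP K (mulP K F Q) R) (pts i)            ≡⟨ sym (eval-cong P (addP K (mulP K F Q) R) (pts i)
                                                               (λ k → trans (P≈ k) (sym (coeff-addP (mulP K F Q) R k)))) ⟩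
        eval P (pts i)                                  ≡⟨ P-roots (pts i) ⟩
        0#                                              ∎
      R≈0 : IsZeroPoly K R
      R≈0 = degLt-roots⇒zero (suc M₁) pts inj R degR R-roots

module FiniteField (K : Field) {N : ℕ} (card : Field.Carrier K ↔ Fin N) where
  open FieldProperties K
  open PolynomialProperties K
  open ≡-Reasoning

  element : Fin N → Carrier
  element = Inverse.from card

  index : Carrier → Fin N
  index = Inverse.to card

  index-element : ∀ i → index (element i) ≡ i
  index-element = Inverse.strictlyInverseˡ card

  element-index : ∀ x → element (index x) ≡ x
  element-index = Inverse.strictlyInverseʳ card

  element-injective : ∀ i j → element i ≡ element j → i ≡ j
  element-injective i j eᵢ≡eⱼ = trans (sym (index-element i)) (trans (cong index eᵢ≡eⱼ) (index-element j))

  infix 4 _≟_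
  _≟_ : (x y : Carrier) → Dec (x ≡ y)
  x ≟ y with index x Fin.≟ index y
  ... | yes iₓ≡iᵧ = yes (trans (sym (element-index x)) (trans (cong element iₓ≡iᵧ) (element-index y)))
  ... | no  iₓ≢iᵧ = no (iₓ≢iᵧ ∘ cong index)

  ∑K ∏K : (Carrier → Carrier) → Carrier
  ∑K g = ∑ (g ∘ element)
  ∏K g = ∏ (g ∘ element)

  module _ (φ ψ : Carrier → Carrier) (φψ : ∀ x → φ (ψ x) ≡ x) (ψφ : ∀ x → ψ (φ x) ≡ x) where

    private
      reindex : ∀ (σ τ : Carrier → Carrier) → (∀ x → σ (τ x) ≡ x) → ∀ i →
                index (σ (element (index (τ (element i))))) ≡ i
      reindex σ τ στ i = trans (cong (index ∘ σ) (element-index _)) (trans (cong index (στ _)) (index-element i))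

      reindexed : ∀ (g : Carrier → Carrier) i → g (φ (element i)) ≡ g (element (index (φ (element i))))
      reindexed g i = cong g (sym (element-index _))

    ∑K-bijection : ∀ g → ∑K (g ∘ φ) ≡ ∑K g
    ∑K-bijection g = trans (∑-cong (reindexed g))
      (∑-permute (g ∘ element) (index ∘ φ ∘ element) (index ∘ ψ ∘ element) (reindex φ ψ φψ) (reindex ψ φ ψφ))

    ∏K-bijection : ∀ g → ∏K (g ∘ φ) ≡ ∏K g
    ∏K-bijection g = trans (*-Sum.sum-cong-≗ (reindexed g))
      (∏-permute (g ∘ element) (index ∘ φ ∘ element) (index ∘ ψ ∘ element) (reindex φ ψ φψ) (reindex ψ φ ψφ))

  -- Translating by 1 permutes K, so N · 1 = ∑K (x + 1) - ∑K x = 0.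
  fromℕ-N≡0 : fromℕ N ≡ 0#
  fromℕ-N≡0 = begin
    fromℕ N                ≡⟨ sym (∑-one N) ⟩
    ∑ {N} (λ _ → 1#)       ≡⟨ x+y≡x⇒y≡0 (trans (sym (∑-distrib-+ element (λ _ → 1#))) translation) ⟩
    0#                     ∎
    where
    translation : ∑K (_+ 1#) ≡ ∑K (λ x → x)
    translation = ∑K-bijection (_+ 1#) (_+ - 1#)
      (λ x → solve 1 (λ x → x :+ :- con (ℤ.+ 1) :+ con (ℤ.+ 1) := x) refl x)
      (λ x → solve 1 (λ x → x :+ con (ℤ.+ 1) :+ :- con (ℤ.+ 1) := x) refl x)
      (λ x → x)

  orOne : Carrier → Carrier
  orOne x with x ≟ 0#
  ... | yes _ = 1#
  ... | no  _ = x

  orOne-≢0 : ∀ x → orOne x ≢ 0#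
  orOne-≢0 x with x ≟ 0#
  ... | yes _   = λ 1≡0 → 0≢1 (sym 1≡0)
  ... | no  x≢0 = x≢0

  scaleOrOne : Carrier → Carrier → Carrier
  scaleOrOne a x with x ≟ 0#
  ... | yes _ = 1#
  ... | no  _ = a

  orOne-* : ∀ a → a ≢ 0# → ∀ x → orOne (a * x) ≡ scaleOrOne a x * orOne x
  orOne-* a a≢0 x with x ≟ 0# | a * x ≟ 0#
  ... | yes _   | yes _    = sym (*-identityˡ 1#)
  ... | yes x≡0 | no ax≢0  = ⊥-elim (ax≢0 (trans (cong (a *_) x≡0) (zeroʳ a)))
  ... | no x≢0  | yes ax≡0 = ⊥-elim (x≢0∧y≢0⇒x*y≢0 a≢0 x≢0 ax≡0)
  ... | no _    | no _     = refl

  -- Multiplication by a ≠ 0 permutes K, so ∏K (orOne (a x)) = ∏K (orOne x) forces a^(N-1) = 1.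
  fermat : ∀ a → pow K a N ≡ a
  fermat a with a ≟ 0#
  ... | yes a≡0 = trans (cong (λ t → pow K t N) a≡0) (trans (0^N≡0 (index 0#)) (sym a≡0))
    where
    0^N≡0 : ∀ {k} → Fin k → pow K 0# k ≡ 0#
    0^N≡0 {suc k} _ = pow-zero k
  ... | no a≢0 with inverse a a≢0
  ... | a⁻¹ , aa⁻¹≡1 = begin
    pow K a N                    ≡⟨ sym (∏-except (scaleOrOne a ∘ element) (index 0#) a scaled at0) ⟩
    ∏K (scaleOrOne a) * a        ≡⟨ cong (_* a) (x*y≡y⇒x≡1 (∏-≢0 (orOne ∘ element) (orOne-≢0 ∘ element)) invariance) ⟩
    1# * a                       ≡⟨ *-identityˡ a ⟩
    a                            ∎
    where
    invariance : ∏K (scaleOrOne a) * ∏K orOne ≡ ∏K orOne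
    invariance = begin
      ∏K (scaleOrOne a) * ∏K orOne         ≡⟨ sym (*-Sum.∑-distrib-+ (scaleOrOne a ∘ element) (orOne ∘ element)) ⟩
      ∏K (λ x → scaleOrOne a x * orOne x)  ≡⟨ sym (*-Sum.sum-cong-≗ (orOne-* a a≢0 ∘ element)) ⟩
      ∏K (orOne ∘ (a *_))                  ≡⟨ ∏K-bijection (a *_) (a⁻¹ *_) (cancel a a⁻¹ aa⁻¹≡1)
                                                 (cancel a⁻¹ a (trans (*-comm a⁻¹ a) aa⁻¹≡1)) orOne ⟩
      ∏K orOne                             ∎
      where
      cancel : ∀ b c → b * c ≡ 1# → ∀ x → b * (c * x) ≡ x
      cancel b c bc≡1 x = trans (sym (*-assoc b c x)) (trans (cong (_* x) bc≡1) (*-identityˡ x))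
    scaled : ∀ i → i ≢ index 0# → scaleOrOne a (element i) ≡ a
    scaled i i≢i₀ with element i ≟ 0#
    ... | yes eᵢ≡0 = ⊥-elim (i≢i₀ (trans (sym (index-element i)) (cong index eᵢ≡0)))
    ... | no _     = refl
    at0 : scaleOrOne a (element (index 0#)) ≡ 1#
    at0 with element (index 0#) ≟ 0#
    ... | yes _  = refl
    ... | no e≢0 = ⊥-elim (e≢0 (element-index 0#))

  xᴺ-x∣⇔vanishes : 2 ℕ.≤ N → ∀ P → _∣P_ K (subP K (powP K (X K) N) (X K)) P ⇔ (∀ z → eval P z ≡ 0#)
  xᴺ-x∣⇔vanishes 2≤N = xᴹ-x∣⇔vanishes N 2≤N element element-injective fermat

  degLt-vanishes⇒zero : ∀ P → DegLt K P N → (∀ z → eval P z ≡ 0#) → IsZeroPoly K P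
  degLt-vanishes⇒zero P deg vanishes = degLt-roots⇒zero N element element-injective P deg (vanishes ∘ element)

  degLt⇒vanishes⇔zero : ∀ P → DegLt K P N → (∀ z → eval P z ≡ 0#) ⇔ IsZeroPoly K P
  degLt⇒vanishes⇔zero P deg = mk⇔ (degLt-vanishes⇒zero P deg) (λ P≈0 z → eval-zeroPoly P z P≈0)

  -- The polynomial ∑ d_u x^(E u) has degree < N and the nonzero coefficient d u₀ at x^(E u₀).
  sparse-nonvanishing : ∀ {m} (d : Fin m → Carrier) (E : Fin m → ℕ) → (∀ u → E u ℕ.< N) →
                        (∀ u u′ → E u ≡ E u′ → u ≡ u′) → ∀ u₀ → d u₀ ≢ 0# →
                        ∃ λ z → ∑ (λ u → d u * pow K z (E u)) ≢ 0#
  sparse-nonvanishing d E E<N E-injective u₀ d₀≢0 with Fin.any? (λ i → ¬? (value (element i) ≟ 0#))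
    where
    value : Carrier → Carrier
    value z = ∑ (λ u → d u * pow K z (E u))
  ... | yes (i , vᵢ≢0) = element i , vᵢ≢0
  ... | no  all≡0      = ⊥-elim (d₀≢0 (begin
    d u₀                 ≡⟨ sym coeff-W-E₀ ⟩
    coeff K W (E u₀)     ≡⟨ degLt-vanishes⇒zero W degW W-vanishes (E u₀) ⟩
    0#                   ∎))
    where
    monomial : Fin _ → Poly K
    monomial u = scaleP K (d u) (powP K (X K) (E u))
    W : Poly K
    W = sumFinP K monomial
    coeff-W : ∀ j → coeff K W j ≡ ∑ (λ u → d u * coeff K (powP K (X K) (E u)) j)
    coeff-W j = trans (coeff-sumFinP monomial j) (∑-cong (λ u → coeff-scaleP (d u) (powP K (X K) (E u)) j))
    degW : DegLt K W N
    degW j N≤j = trans (coeff-W j) (∑-zero _ (λ u → trans (cong (d u *_)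
      (coeff-powP-X-≢ (E u) j (λ j≡Eu → ℕ.<-irrefl (sym j≡Eu) (ℕ.<-≤-trans (E<N u) N≤j)))) (zeroʳ _)))
    coeff-W-E₀ : coeff K W (E u₀) ≡ d u₀
    coeff-W-E₀ = trans (coeff-W (E u₀)) (trans (∑-single _ u₀ others) (trans (cong (d u₀ *_) (coeff-powP-X-≡ (E u₀))) (*-identityʳ _)))
      where
      others : ∀ u → u ≢ u₀ → d u * coeff K (powP K (X K) (E u)) (E u₀) ≡ 0#
      others u u≢u₀ = trans (cong (d u *_) (coeff-powP-X-≢ (E u) (E u₀) (λ eq → u≢u₀ (E-injective u u₀ (sym eq))))) (zeroʳ _)
    vanishes-at-elements : ∀ i → ∑ (λ u → d u * pow K (element i) (E u)) ≡ 0#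
    vanishes-at-elements i with ∑ (λ u → d u * pow K (element i) (E u)) ≟ 0#
    ... | yes v≡0 = v≡0
    ... | no  v≢0 = ⊥-elim (all≡0 (i , v≢0))
    W-vanishes : ∀ z → eval W z ≡ 0#
    W-vanishes z = trans (eval-sumFinP monomial z) (trans (∑-cong (λ u → trans (eval-scaleP (d u) (powP K (X K) (E u)) z) (cong (d u *_) (eval-powP-X (E u) z))))
                (trans (cong (λ t → ∑ (λ u → d u * pow K t (E u))) (sym (element-index z)))
                  (vanishes-at-elements (index z))))

prime≥2 : ∀ {p} → Prime p → 2 ℕ.≤ p
prime≥2 {p} p-prime = ℕ.nonTrivial⇒n>1 p {{prime⇒nonTrivial p-prime}}

p∤m! : ∀ {p} → Prime p → ∀ m → m ℕ.< p → ¬ (p ∣ m !)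
p∤m! p-prime zero    m<p p∣1 = ¬prime[1] (subst Prime (∣1⇒≡1 p∣1) p-prime)
p∤m! p-prime (suc m) m<p p∣m! with euclidsLemma (suc m) (m !) p-prime p∣m!
... | inj₁ p∣1+m = ℕ.<⇒≱ m<p (∣⇒≤ p∣1+m)
... | inj₂ p∣m!  = p∤m! p-prime m (ℕ.<-trans (ℕ.n<1+n m) m<p) p∣m!

n!≡nCk*k![n∸k]! : ∀ n k → k ℕ.≤ n → n ! ≡ (n C k) ℕ.* (k ! ℕ.* (n ℕ.∸ k) !)
n!≡nCk*k![n∸k]! n k k≤n with k![n∸k]!∣n! {n} {k} k≤n
... | divides c n!≡c*d = trans n!≡c*d (cong (ℕ._* (k ! ℕ.* (n ℕ.∸ k) !)) c≡nCk)
  where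
  instance _ = ℕ._!*_!≢0 k (n ℕ.∸ k)
  c≡nCk : c ≡ n C k
  c≡nCk = sym (trans (nCk≡n!/k![n-k]! k≤n) (trans (/-congˡ n!≡c*d) (m*n/n≡m c _)))

p∣pCk : ∀ {p} → Prime p → ∀ k → 0 ℕ.< k → k ℕ.< p → p ∣ (p C k)
p∣pCk {p@(suc p′)} p-prime k 0<k k<p
  with euclidsLemma (p C k) (k ! ℕ.* (p ℕ.∸ k) !) p-prime
         (subst (p ∣_) (n!≡nCk*k![n∸k]! p k (ℕ.<⇒≤ k<p)) (divides (p′ !) (ℕ.*-comm p (p′ !))))
... | inj₁ p∣pCk = p∣pCk
... | inj₂ p∣k![p∸k]! with euclidsLemma (k !) ((p ℕ.∸ k) !) p-prime p∣k![p∸k]!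
...   | inj₁ p∣k!     = ⊥-elim (p∤m! p-prime k k<p p∣k!)
...   | inj₂ p∣[p∸k]! = ⊥-elim (p∤m! p-prime (p ℕ.∸ k) (ℕ.∸-monoʳ-< 0<k (ℕ.<⇒≤ k<p)) p∣[p∸k]!)

module Frobenius (K : Field) {p : ℕ} (p-prime : Prime p) (p≡0 : FieldProperties.fromℕ K p ≡ Field.0# K) where
  open FieldProperties K
  open ≡-Reasoning
  private module B = Binomial commutativeSemiring
  open import Algebra.Properties.Semiring.Mult semiring using () renaming (_×_ to _×ₘ_)

  ×ₘ≡fromℕ* : ∀ m x → m ×ₘ x ≡ fromℕ m * x
  ×ₘ≡fromℕ* zero    x = sym (zeroˡ x)
  ×ₘ≡fromℕ* (suc m) x = trans (cong (x +_) (×ₘ≡fromℕ* m x)) (trans (cong (_+ fromℕ m * x) (sym (*-identityˡ x))) (sym (distribʳ _ _ _)))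

  -- In the binomial expansion of (x + y)^p only the two extreme terms survive.
  pow-p-+ : ∀ x y → pow K (x + y) p ≡ pow K x p + pow K y p
  pow-p-+ x y with prime≥2 p-prime
  ... | s≤s (s≤s {n = p″} _) = begin
    pow K (x + y) p                        ≡⟨ trans (pow≡^ (x + y) p) (B.theorem p x y) ⟩
    B.binomialExpansion x y p              ≡⟨ sym (∑≡sum (B.binomialTerm x y p)) ⟩
    ∑ (B.binomialTerm x y p)               ≡⟨ cong (term zero +_) (∑-single (term ∘ suc) (Fin.fromℕ (suc p″)) middle) ⟩
    term zero + term (Fin.fromℕ p)         ≡⟨ cong₂ _+_ first last ⟩
    pow K y p + pow K x p                  ≡⟨ +-comm _ _ ⟩
    pow K x p + pow K y p                  ∎
    where
    term = B.binomialTerm x y p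
    middle : ∀ i → i ≢ Fin.fromℕ (suc p″) → term (suc i) ≡ 0#
    middle i i≢last = begin
      term (suc i)                         ≡⟨ ×ₘ≡fromℕ* (p C j) _ ⟩
      fromℕ (p C j) * B.binomial x y p (suc i) ≡⟨ cong (_* B.binomial x y p (suc i)) p∣⇒0 ⟩
      0# * B.binomial x y p (suc i)        ≡⟨ zeroˡ _ ⟩
      0#                                   ∎
      where
      j = suc (toℕ i)
      j<p : j ℕ.< p
      j<p = s≤s (ℕ.≤∧≢⇒< (ℕ.≤-pred (Fin.toℕ<n i)) (i≢last ∘ λ eq → Fin.toℕ-injective (trans eq (sym (Fin.toℕ-fromℕ _)))))
      p∣⇒0 : fromℕ (p C j) ≡ 0#
      p∣⇒0 with p∣pCk p-prime j (s≤s z≤n) j<p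
      ... | divides c pCj≡c*p = begin
        fromℕ (p C j)             ≡⟨ cong fromℕ pCj≡c*p ⟩
        fromℕ (c ℕ.* p)           ≡⟨ fromℕ-* c p ⟩
        fromℕ c * fromℕ p         ≡⟨ cong (fromℕ c *_) p≡0 ⟩
        fromℕ c * 0#              ≡⟨ zeroʳ _ ⟩
        0#                        ∎
    first : term zero ≡ pow K y p
    first = trans (×ₘ≡fromℕ* 1 _) (trans (cong (_* (1# * y ^ p)) (+-identityʳ 1#))
              (trans (*-identityˡ _) (trans (*-identityˡ _) (sym (pow≡^ y p)))))
    last : term (Fin.fromℕ p) ≡ pow K x p
    last = begin
      term (Fin.fromℕ p)                                        ≡⟨ ×ₘ≡fromℕ* (p C toℕ (Fin.fromℕ p)) _ ⟩
      fromℕ (p C toℕ (Fin.fromℕ p)) * (x ^ toℕ (Fin.fromℕ p) * y ^ (p ℕ.∸ toℕ (Fin.fromℕ p)))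
                                                            ≡⟨ cong (λ t → fromℕ (p C t) * (x ^ t * y ^ (p ℕ.∸ t))) (Fin.toℕ-fromℕ p) ⟩
      fromℕ (p C p) * (x ^ p * y ^ (p ℕ.∸ p))               ≡⟨ cong₂ (λ s t → fromℕ s * (x ^ p * y ^ t)) (nCn≡1 p) (ℕ.n∸n≡0 p) ⟩
      fromℕ 1 * (x ^ p * 1#)                                ≡⟨ trans (cong (_* (x ^ p * 1#)) (+-identityʳ 1#)) (trans (*-identityˡ _) (*-identityʳ _)) ⟩
      x ^ p                                                 ≡⟨ sym (pow≡^ x p) ⟩
      pow K x p                                             ∎

  pow-pʲ-+ : ∀ j x y → pow K (x + y) (p ℕ.^ j) ≡ pow K x (p ℕ.^ j) + pow K y (p ℕ.^ j)
  pow-pʲ-+ zero    x y = trans (*-identityʳ _) (sym (cong₂ _+_ (*-identityʳ x) (*-identityʳ y)))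
  pow-pʲ-+ (suc j) x y = begin
    pow K (x + y) (p ℕ.* p ℕ.^ j)                          ≡⟨ pow-* (x + y) p (p ℕ.^ j) ⟩
    pow K (pow K (x + y) p) (p ℕ.^ j)                      ≡⟨ cong (λ t → pow K t (p ℕ.^ j)) (pow-p-+ x y) ⟩
    pow K (pow K x p + pow K y p) (p ℕ.^ j)                ≡⟨ pow-pʲ-+ j _ _ ⟩
    pow K (pow K x p) (p ℕ.^ j) + pow K (pow K y p) (p ℕ.^ j) ≡⟨ sym (cong₂ _+_ (pow-* x p (p ℕ.^ j)) (pow-* y p (p ℕ.^ j))) ⟩
    pow K x (p ℕ.* p ℕ.^ j) + pow K y (p ℕ.* p ℕ.^ j)      ∎

module FrobeniusPowers (K : Field) {q n : ℕ} (q-primePower : IsPrimePower q)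
                       (card : Field.Carrier K ↔ Fin (q ℕ.^ n)) {{n≢0 : NonZero n}} where
  open FieldProperties K
  open FiniteField K card
  open ≡-Reasoning

  private
    p = proj₁ q-primePower
    k = proj₁ (proj₂ q-primePower)
    p-prime = proj₁ (proj₂ (proj₂ q-primePower))
    1≤k = proj₁ (proj₂ (proj₂ (proj₂ q-primePower)))
    q≡pᵏ = proj₂ (proj₂ (proj₂ (proj₂ q-primePower)))

    qᵐ≡pᵏᵐ : ∀ m → q ℕ.^ m ≡ p ℕ.^ (k ℕ.* m)
    qᵐ≡pᵏᵐ m = trans (cong (ℕ._^ m) q≡pᵏ) (ℕ.^-*-assoc p k m)

  -- p · 1 ≠ 0 would make (p · 1)^(kn) = q^n · 1 nonzero.
  fromℕ-p≡0 : fromℕ p ≡ 0#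
  fromℕ-p≡0 with fromℕ p ≟ 0#
  ... | yes p≡0 = p≡0
  ... | no  p≢0 = contradiction (begin
    pow K (fromℕ p) (k ℕ.* n)    ≡⟨ sym (fromℕ-^ p (k ℕ.* n)) ⟩
    fromℕ (p ℕ.^ (k ℕ.* n))      ≡⟨ cong fromℕ (sym (qᵐ≡pᵏᵐ n)) ⟩
    fromℕ (q ℕ.^ n)              ≡⟨ fromℕ-N≡0 ⟩
    0#                           ∎) (pow-≢0 (k ℕ.* n) p≢0)

  open Frobenius K p-prime fromℕ-p≡0

  frob : ℕ → Carrier → Carrier
  frob m z = pow K z (q ℕ.^ m)

  frob-+ : ∀ m x y → frob m (x + y) ≡ frob m x + frob m y
  frob-+ m x y rewrite qᵐ≡pᵏᵐ m = pow-pʲ-+ (k ℕ.* m) x y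

  frob-* : ∀ m x y → frob m (x * y) ≡ frob m x * frob m y
  frob-* m x y = pow-distrib-* x y (q ℕ.^ m)

  frob-0 : ∀ m → frob m 0# ≡ 0#
  frob-0 m = x+y≡x⇒y≡0 (sym (trans (cong (frob m) (sym (+-identityʳ 0#))) (frob-+ m 0# 0#)))

  frob-zero : ∀ x → frob 0 x ≡ x
  frob-zero = *-identityʳ

  frob-frob : ∀ a b x → frob a (frob b x) ≡ frob (b ℕ.+ a) x
  frob-frob a b x = trans (sym (pow-* x (q ℕ.^ b) (q ℕ.^ a))) (cong (pow K x) (sym (ℕ.^-distribˡ-+-* q b a)))

  frob-n : ∀ x → frob n x ≡ x
  frob-n = fermat

  frob-∑ : ∀ m {t} (f : Fin t → Carrier) → frob m (∑ f) ≡ ∑ (λ i → frob m (f i))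
  frob-∑ m {ℕ.zero}  f = frob-0 m
  frob-∑ m {ℕ.suc t} f = trans (frob-+ m _ _) (cong (frob m (f zero) +_) (frob-∑ m (f ∘ suc)))

  frob-≢0 : ∀ m {x} → x ≢ 0# → frob m x ≢ 0#
  frob-≢0 m = pow-≢0 (q ℕ.^ m)

  frob-multiple : ∀ c x → frob (c ℕ.* n) x ≡ x
  frob-multiple ℕ.zero    x = frob-zero x
  frob-multiple (ℕ.suc c) x = trans (sym (frob-frob (c ℕ.* n) n x)) (trans (frob-multiple c (frob n x)) (frob-n x))

  frob-% : ∀ a x → frob a x ≡ frob (a % n) x
  frob-% a x = begin
    frob a x                                   ≡⟨ cong (λ t → frob t x) (m≡m%n+[m/n]*n a n) ⟩
    frob (a % n ℕ.+ (a / n) ℕ.* n) x           ≡⟨ sym (frob-frob ((a / n) ℕ.* n) (a % n) x) ⟩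
    frob ((a / n) ℕ.* n) (frob (a % n) x)      ≡⟨ frob-multiple (a / n) _ ⟩
    frob (a % n) x                             ∎

  frob-cong-% : ∀ a b x → a % n ≡ b % n → frob a x ≡ frob b x
  frob-cong-% a b x a≡b = trans (frob-% a x) (trans (cong (λ t → frob t x) a≡b) (sym (frob-% b x)))

  frob-inverse : ∀ m x → m ℕ.≤ n → frob m (frob (n ℕ.∸ m) x) ≡ x
  frob-inverse m x m≤n = trans (frob-frob m (n ℕ.∸ m) x) (trans (cong (λ t → frob t x) (ℕ.m∸n+n≡m m≤n)) (frob-n x))

  1<q : 1 ℕ.< q
  1<q = subst (1 ℕ.<_) (sym q≡pᵏ) (ℕ.^-monoʳ-< p (prime≥2 p-prime) 1≤k)

  ^-injective : ∀ a b → q ℕ.^ a ≡ q ℕ.^ b → a ≡ b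
  ^-injective a b qᵃ≡qᵇ with ℕ.<-cmp a b
  ... | tri< a<b _ _ = contradiction qᵃ≡qᵇ (ℕ.<⇒≢ (ℕ.^-monoʳ-< q 1<q a<b))
  ... | tri≈ _ a≡b _ = a≡b
  ... | tri> _ _ b<a = contradiction (sym qᵃ≡qᵇ) (ℕ.<⇒≢ (ℕ.^-monoʳ-< q 1<q b<a))

module Determinant (K : Field) where
  open FieldProperties K
  open PolynomialProperties K
  open ≡-Reasoning

  Mat : ℕ → Set
  Mat k = Fin k → Fin k → Carrier

  minor : ∀ {k} → Mat (suc k) → Fin (suc k) → Mat k
  minor M i r c = M (suc r) (punchIn i c)

  detK : ∀ {k} → Mat k → Carrier
  detK {zero}  M = 1#
  detK {suc k} M = ∑ (λ i → sign (toℕ i) (M zero i * detK (minor M i)))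

  detK-cong : ∀ {k} (M M′ : Mat k) → (∀ r c → M r c ≡ M′ r c) → detK M ≡ detK M′
  detK-cong {zero}  M M′ M≗M′ = refl
  detK-cong {suc k} M M′ M≗M′ = ∑-cong (λ i → cong (sign (toℕ i)) (cong₂ _*_ (M≗M′ zero i)
    (detK-cong (minor M i) (minor M′ i) (λ r c → M≗M′ (suc r) (punchIn i c)))))

  eval-det : ∀ {k} (M : Fin k → Fin k → Poly K) x → eval (det K M) x ≡ detK (λ r c → eval (M r c) x)
  eval-det {zero}  M x = trans (cong (1# +_) (zeroʳ x)) (+-identityʳ 1#)
  eval-det {suc k} M x = trans (eval-sumFinP term x) (∑-cong (λ i → begin
    eval (term i) x                                          ≡⟨ eval-signP (toℕ i) (mulP K (M zero i) (minorDet i)) x ⟩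
    sign (toℕ i) (eval (mulP K (M zero i) (minorDet i)) x)   ≡⟨ cong (sign (toℕ i)) (eval-mulP (M zero i) (minorDet i) x) ⟩
    sign (toℕ i) (eval (M zero i) x * eval (minorDet i) x)   ≡⟨ cong (λ t → sign (toℕ i) (eval (M zero i) x * t)) (eval-det (λ r c → M (suc r) (punchIn i c)) x) ⟩
    sign (toℕ i) (eval (M zero i) x * detK (λ r c → eval (M (suc r) (punchIn i c)) x)) ∎))
    where
    minorDet term : Fin (suc k) → Poly K
    minorDet i = det K (λ r c → M (suc r) (punchIn i c))
    term     i = signP K (toℕ i) (mulP K (M zero i) (minorDet i))

  private
    detK-termwise : ∀ {k} (M A B : Mat (suc k)) t →
                    (∀ i → M zero i * detK (minor M i) ≡ A zero i * detK (minor A i) + t * (B zero i * detK (minor B i))) →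
                    detK M ≡ detK A + t * detK B
    detK-termwise M A B t terms = begin
      detK M                                 ≡⟨ ∑-cong (λ i → trans (cong (sign (toℕ i)) (terms i)) (sign-+ (toℕ i) _ _)) ⟩
      ∑ (λ i → termA i + tTermB i)           ≡⟨ ∑-distrib-+ termA tTermB ⟩
      detK A + ∑ tTermB                      ≡⟨ cong (detK A +_) (trans (∑-cong (λ i → sign-* (toℕ i) t (B zero i * detK (minor B i))))
                                                                       (*-distribˡ-∑ t termB)) ⟩
      detK A + t * detK B                    ∎
      where
      termA termB tTermB : _ → Carrier
      termA  i = sign (toℕ i) (A zero i * detK (minor A i))
      termB  i = sign (toℕ i) (B zero i * detK (minor B i))
      tTermB i = sign (toℕ i) (t * (B zero i * detK (minor B i)))

  detK-linear : ∀ {k} (r : Fin k) (M A B : Mat k) t →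
                (∀ r′ → r′ ≢ r → ∀ c → M r′ c ≡ A r′ c) → (∀ r′ → r′ ≢ r → ∀ c → M r′ c ≡ B r′ c) →
                (∀ c → M r c ≡ A r c + t * B r c) → detK M ≡ detK A + t * detK B
  detK-linear {suc k} zero M A B t M≗A M≗B row = detK-termwise M A B t λ i → begin
    M zero i * δ i                        ≡⟨ cong (_* δ i) (row i) ⟩
    (A zero i + t * B zero i) * δ i       ≡⟨ solve 4 (λ a t b d → (a :+ t :* b) :* d := a :* d :+ t :* (b :* d)) refl (A zero i) t (B zero i) (δ i) ⟩
    A zero i * δ i + t * (B zero i * δ i) ≡⟨ cong₂ (λ x y → A zero i * x + t * (B zero i * y))
                                               (detK-cong _ _ (λ r c → M≗A (suc r) (λ ()) (punchIn i c)))
                                               (detK-cong _ _ (λ r c → M≗B (suc r) (λ ()) (punchIn i c))) ⟩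
    A zero i * detK (minor A i) + t * (B zero i * detK (minor B i)) ∎
    where
    δ : Fin (suc k) → Carrier
    δ i = detK (minor M i)
  detK-linear {suc k} (suc r) M A B t M≗A M≗B row = detK-termwise M A B t λ i → begin
    M zero i * detK (minor M i)                                      ≡⟨ cong (M zero i *_) (minor-linear i) ⟩
    M zero i * (detK (minor A i) + t * detK (minor B i))             ≡⟨ solve 4 (λ m a t b → m :* (a :+ t :* b) := m :* a :+ t :* (m :* b)) refl (M zero i) _ t _ ⟩
    M zero i * detK (minor A i) + t * (M zero i * detK (minor B i))  ≡⟨ cong₂ (λ x y → x * detK (minor A i) + t * (y * detK (minor B i)))
                                                                          (M≗A zero (λ ()) i) (M≗B zero (λ ()) i) ⟩
    A zero i * detK (minor A i) + t * (B zero i * detK (minor B i))  ∎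
    where
    minor-linear : ∀ i → detK (minor M i) ≡ detK (minor A i) + t * detK (minor B i)
    minor-linear i = detK-linear r (minor M i) (minor A i) (minor B i) t
      (λ r′ r′≢r c → M≗A (suc r′) (r′≢r ∘ Fin.suc-injective) (punchIn i c))
      (λ r′ r′≢r c → M≗B (suc r′) (r′≢r ∘ Fin.suc-injective) (punchIn i c))
      (λ c → row (punchIn i c))

  detK-zeroColumn : ∀ {k} (M : Mat k) c₀ → (∀ r → M r c₀ ≡ 0#) → detK M ≡ 0#
  detK-zeroColumn {suc k} M c₀ column≡0 = ∑-zero _ (λ i → trans (cong (sign (toℕ i)) (term≡0 i)) (sign-0 (toℕ i)))
    where
    term≡0 : ∀ i → M zero i * detK (minor M i) ≡ 0#
    term≡0 i with i Fin.≟ c₀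
    ... | yes refl = trans (cong (_* detK (minor M i)) (column≡0 zero)) (zeroˡ _)
    ... | no  i≢c₀ = trans (cong (M zero i *_) (detK-zeroColumn (minor M i) (punchOut i≢c₀)
                       (λ r → trans (cong (M (suc r)) (Fin.punchIn-punchOut i≢c₀)) (column≡0 (suc r))))) (zeroʳ _)

  detK-expandColumn₀ : ∀ {k} (M : Mat (suc k)) → (∀ r → M (suc r) zero ≡ 0#) → detK M ≡ M zero zero * detK (minor M zero)
  detK-expandColumn₀ {zero}  M below≡0 = +-identityʳ _
  detK-expandColumn₀ {suc k} M below≡0 = trans (cong (M zero zero * detK (minor M zero) +_) (∑-zero _ term≡0)) (+-identityʳ _)
    where
    term≡0 : ∀ i → sign (toℕ (suc i)) (M zero (suc i) * detK (minor M (suc i))) ≡ 0#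
    term≡0 i = trans (cong (sign (suc (toℕ i))) (trans (cong (M zero (suc i) *_) (detK-zeroColumn (minor M (suc i)) zero below≡0)) (zeroʳ _)))
                     (sign-0 (suc (toℕ i)))

  ∑-pairs-cancel : ∀ m (T : Fin (suc m) → Fin (suc m) → Carrier) → (∀ i j → i ≢ j → T i j + T j i ≡ 0#) →
                   ∑ (λ i → ∑ (λ (k : Fin m) → T i (punchIn i k))) ≡ 0#
  ∑-pairs-cancel zero    T antisym = ∑-zero {1} (λ _ → 0#) (λ _ → refl)
  ∑-pairs-cancel (suc m) T antisym = begin
    ∑ row₀ + ∑ (λ i → T (suc i) zero + ∑ (λ k → T (suc i) (suc (punchIn i k))))
      ≡⟨ cong (∑ row₀ +_) (∑-distrib-+ column₀ (λ i → ∑ (λ k → T (suc i) (suc (punchIn i k))))) ⟩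
    ∑ row₀ + (∑ column₀ + ∑ (λ i → ∑ (λ k → T (suc i) (suc (punchIn i k)))))
      ≡⟨ cong (λ z → ∑ row₀ + (∑ column₀ + z))
              (∑-pairs-cancel m (λ i j → T (suc i) (suc j)) (λ i j i≢j → antisym (suc i) (suc j) (i≢j ∘ Fin.suc-injective))) ⟩
    ∑ row₀ + (∑ column₀ + 0#)
      ≡⟨ cong (∑ row₀ +_) (+-identityʳ _) ⟩
    ∑ row₀ + ∑ column₀
      ≡⟨ sym (∑-distrib-+ row₀ column₀) ⟩
    ∑ (λ k → T zero (suc k) + T (suc k) zero)
      ≡⟨ ∑-zero _ (λ k → antisym zero (suc k) (λ ())) ⟩
    0# ∎
    where
    row₀ column₀ : Fin (suc m) → Carrier
    row₀    k = T zero (suc k)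
    column₀ i = T (suc i) zero

  -- Position of j in the row of i once i is removed (a junk value when i ≡ j).
  punchOut′ : ∀ {m} → Fin (suc (suc m)) → Fin (suc (suc m)) → Fin (suc m)
  punchOut′         zero    zero    = zero
  punchOut′         zero    (suc j) = j
  punchOut′         (suc i) zero    = zero
  punchOut′ {suc m} (suc i) (suc j) = suc (punchOut′ i j)
  punchOut′ {zero}  (suc i) (suc j) = zero

  punchIn-punchOut′ : ∀ {m} (i j : Fin (suc (suc m))) → i ≢ j → punchIn i (punchOut′ i j) ≡ j
  punchIn-punchOut′         zero          zero          i≢j = ⊥-elim (i≢j refl)
  punchIn-punchOut′         zero          (suc j)       i≢j = refl
  punchIn-punchOut′         (suc i)       zero          i≢j = refl
  punchIn-punchOut′ {suc m} (suc i)       (suc j)       i≢j = cong suc (punchIn-punchOut′ i j (i≢j ∘ cong suc))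
  punchIn-punchOut′ {zero}  (suc zero)    (suc zero)    i≢j = ⊥-elim (i≢j refl)

  punchOut′-punchIn : ∀ {m} (i : Fin (suc (suc m))) (k : Fin (suc m)) → punchOut′ i (punchIn i k) ≡ k
  punchOut′-punchIn         zero    k       = refl
  punchOut′-punchIn         (suc i) zero    = refl
  punchOut′-punchIn {suc m} (suc i) (suc k) = cong suc (punchOut′-punchIn i k)

  punchIn-punchOut′-comm : ∀ {m} (i j : Fin (suc (suc m))) → i ≢ j → ∀ (c : Fin m) →
                           punchIn i (punchIn (punchOut′ i j) c) ≡ punchIn j (punchIn (punchOut′ j i) c)
  punchIn-punchOut′-comm         zero    zero    i≢j c       = ⊥-elim (i≢j refl)
  punchIn-punchOut′-comm         zero    (suc j) i≢j c       = refl
  punchIn-punchOut′-comm         (suc i) zero    i≢j c       = refl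
  punchIn-punchOut′-comm {suc m} (suc i) (suc j) i≢j zero    = refl
  punchIn-punchOut′-comm {suc m} (suc i) (suc j) i≢j (suc c) = cong suc (punchIn-punchOut′-comm i j (i≢j ∘ cong suc) c)

  sign-punchOut′-cancel : ∀ {m} (i j : Fin (suc (suc m))) → i ≢ j → ∀ x →
                          sign (toℕ i) (sign (toℕ (punchOut′ i j)) x) + sign (toℕ j) (sign (toℕ (punchOut′ j i)) x) ≡ 0#
  sign-punchOut′-cancel         zero       zero       i≢j x = ⊥-elim (i≢j refl)
  sign-punchOut′-cancel         zero       (suc j)    i≢j x = trans (cong (sign (toℕ j) x +_) (sign-suc (toℕ j) x)) (-‿inverseʳ _)
  sign-punchOut′-cancel         (suc i)    zero       i≢j x = trans (cong (_+ sign (toℕ i) x) (sign-suc (toℕ i) x)) (-‿inverseˡ _)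
  sign-punchOut′-cancel {suc m} (suc i)    (suc j)    i≢j x =
    trans (cong₂ _+_ (sign-suc-suc (toℕ i) (toℕ (punchOut′ i j)) x) (sign-suc-suc (toℕ j) (toℕ (punchOut′ j i)) x))
          (sign-punchOut′-cancel i j (i≢j ∘ cong suc) x)
  sign-punchOut′-cancel {zero}  (suc zero) (suc zero) i≢j x = ⊥-elim (i≢j refl)

  -- Expanding along the two equal rows, the term using columns (i, j) cancels the one using (j, i).
  detK-equalRows₀₁ : ∀ {m} (M : Mat (suc (suc m))) → (∀ c → M zero c ≡ M (suc zero) c) → detK M ≡ 0#
  detK-equalRows₀₁ {m} M row₀≡row₁ = trans expand (∑-pairs-cancel (suc m) τ antisym)
    where
    a : Fin (suc (suc m)) → Carrier
    a = M zero
    D : Fin (suc (suc m)) → Fin (suc m) → Carrier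
    D i k = detK (λ r c → M (suc (suc r)) (punchIn i (punchIn k c)))
    F G : Fin (suc (suc m)) → Fin (suc m) → Carrier
    F i k = sign (toℕ k) (a (punchIn i k) * D i k)
    G i k = sign (toℕ i) (sign (toℕ k) (a i * a (punchIn i k) * D i k))
    τ : Fin (suc (suc m)) → Fin (suc (suc m)) → Carrier
    τ i j = G i (punchOut′ i j)
    expand : detK M ≡ ∑ (λ i → ∑ (λ k → τ i (punchIn i k)))
    expand = ∑-cong (λ i → begin
      sign (toℕ i) (a i * detK (minor M i))   ≡⟨ cong (λ z → sign (toℕ i) (a i * z)) (∑-cong (use-row₁ i)) ⟩
      sign (toℕ i) (a i * ∑ (F i))            ≡⟨ cong (sign (toℕ i)) (sym (*-distribˡ-∑ (a i) (F i))) ⟩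
      sign (toℕ i) (∑ (λ k → a i * F i k))    ≡⟨ sign-∑ (toℕ i) (λ k → a i * F i k) ⟩
      ∑ (λ k → sign (toℕ i) (a i * F i k))    ≡⟨ ∑-cong {f = λ k → sign (toℕ i) (a i * F i k)} (reassociate i) ⟩
      ∑ (G i)                                 ≡⟨ ∑-cong (λ k → cong (G i) (sym (punchOut′-punchIn i k))) ⟩
      ∑ (λ k → τ i (punchIn i k))             ∎)
      where
      use-row₁ : ∀ i k → sign (toℕ k) (M (suc zero) (punchIn i k) * D i k) ≡ F i k
      use-row₁ i k = cong (λ z → sign (toℕ k) (z * D i k)) (sym (row₀≡row₁ (punchIn i k)))
      reassociate : ∀ i k → sign (toℕ i) (a i * F i k) ≡ G i k
      reassociate i k = cong (sign (toℕ i)) (trans (sym (sign-* (toℕ k) (a i) _))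
                          (cong (sign (toℕ k)) (sym (*-assoc (a i) (a (punchIn i k)) (D i k)))))
    antisym : ∀ i j → i ≢ j → τ i j + τ j i ≡ 0#
    antisym i j i≢j = begin
      τ i j + τ j i                                                             ≡⟨ cong₂ _+_ (cong (sign (toℕ i) ∘ sign (toℕ (punchOut′ i j))) termᵢⱼ)
                                                                                                 (cong (sign (toℕ j) ∘ sign (toℕ (punchOut′ j i))) termⱼᵢ) ⟩
      sign (toℕ i) (sign (toℕ (punchOut′ i j)) Y) + sign (toℕ j) (sign (toℕ (punchOut′ j i)) Y) ≡⟨ sign-punchOut′-cancel i j i≢j Y ⟩
      0#                                                                        ∎
      where
      Y = a i * a j * D i (punchOut′ i j)
      termᵢⱼ : a i * a (punchIn i (punchOut′ i j)) * D i (punchOut′ i j) ≡ Y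
      termᵢⱼ = cong (λ z → a i * a z * D i (punchOut′ i j)) (punchIn-punchOut′ i j i≢j)
      termⱼᵢ : a j * a (punchIn j (punchOut′ j i)) * D j (punchOut′ j i) ≡ Y
      termⱼᵢ = trans (cong (λ z → a j * a z * D j (punchOut′ j i)) (punchIn-punchOut′ j i (i≢j ∘ sym)))
        (cong₂ _*_ (*-comm (a j) (a i)) (detK-cong _ _ (λ r c → cong (M (suc (suc r))) (sym (punchIn-punchOut′-comm i j i≢j c)))))

  setRow : ∀ {k} → Mat k → Fin k → (Fin k → Carrier) → Mat k
  setRow M r row = updateAt M r (λ _ → row)

  setRow-≡ : ∀ {k} (M : Mat k) r row c → setRow M r row r c ≡ row c
  setRow-≡ M r row c = cong-app (updateAt-updates r M) c

  setRow-≢ : ∀ {k} (M : Mat k) r row {r′} → r′ ≢ r → ∀ c → setRow M r row r′ c ≡ M r′ c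
  setRow-≢ M r row r′≢r c = cong-app (updateAt-minimal _ r M r′≢r) c

  Alternating : ℕ → Set
  Alternating k = ∀ (M : Mat k) (r s : Fin k) → r ≢ s → (∀ c → M r c ≡ M s c) → detK M ≡ 0#

  alternating-suc : ∀ {k} → Alternating k → ∀ (M : Mat (suc k)) (r s : Fin k) → r ≢ s →
                    (∀ c → M (suc r) c ≡ M (suc s) c) → detK M ≡ 0#
  alternating-suc alternating M r s r≢s rowᵣ≡rowₛ = ∑-zero _ (λ i → trans (cong (sign (toℕ i))
    (trans (cong (M zero i *_) (alternating (minor M i) r s r≢s (rowᵣ≡rowₛ ∘ punchIn i))) (zeroʳ _))) (sign-0 (toℕ i)))

  -- Bilinearity in rows a and b turns det(u+w, u+w) = 0 into det(u, w) + det(w, u) = 0.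
  module _ {k} (M : Mat k) {a b : Fin k} (a≢b : a ≢ b) where

    setRows : (Fin k → Carrier) → (Fin k → Carrier) → Mat k
    setRows x y = setRow (setRow M a x) b y

    setRows-a : ∀ x y c → setRows x y a c ≡ x c
    setRows-a x y c = trans (setRow-≢ _ b y a≢b c) (setRow-≡ M a x c)

    setRows-b : ∀ x y c → setRows x y b c ≡ y c
    setRows-b x y = setRow-≡ _ b y

    private
      setRows-≢ : ∀ x x′ y y′ r → r ≢ a → r ≢ b → ∀ c → setRows x y r c ≡ setRows x′ y′ r c
      setRows-≢ x x′ y y′ r r≢a r≢b c = trans (setRow-≢ _ b y r≢b c) (trans (setRow-≢ M a x r≢a c)
                                          (sym (trans (setRow-≢ _ b y′ r≢b c) (setRow-≢ M a x′ r≢a c))))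

      _⊕_ : (Fin k → Carrier) → (Fin k → Carrier) → Fin k → Carrier
      (x ⊕ y) c = x c + y c

      additiveˡ : ∀ x y z → detK (setRows (x ⊕ y) z) ≡ detK (setRows x z) + detK (setRows y z)
      additiveˡ x y z = trans
        (detK-linear a (setRows (x ⊕ y) z) (setRows x z) (setRows y z) 1#
          (λ r r≢a c → off r r≢a c x) (λ r r≢a c → off r r≢a c y)
          (λ c → trans (setRows-a _ z c) (cong₂ _+_ (sym (setRows-a x z c))
                                          (sym (trans (*-identityˡ _) (setRows-a y z c))))))
        (cong (detK (setRows x z) +_) (*-identityˡ _))
        where
        off : ∀ r → r ≢ a → ∀ c x′ → setRows (x ⊕ y) z r c ≡ setRows x′ z r c
        off r r≢a c x′ with r Fin.≟ b
        ... | yes refl = trans (setRows-b _ z c) (sym (setRows-b x′ z c))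
        ... | no r≢b   = setRows-≢ _ x′ z z r r≢a r≢b c

      additiveʳ : ∀ x y z → detK (setRows x (y ⊕ z)) ≡ detK (setRows x y) + detK (setRows x z)
      additiveʳ x y z = trans
        (detK-linear b (setRows x (y ⊕ z)) (setRows x y) (setRows x z) 1#
          (λ r r≢b c → trans (setRow-≢ _ b (y ⊕ z) r≢b c) (sym (setRow-≢ _ b y r≢b c)))
          (λ r r≢b c → trans (setRow-≢ _ b (y ⊕ z) r≢b c) (sym (setRow-≢ _ b z r≢b c)))
          (λ c → trans (setRows-b x _ c) (cong₂ _+_ (sym (setRows-b x y c)) (sym (trans (*-identityˡ _) (setRows-b x z c))))))
        (cong (detK (setRows x y) +_) (*-identityˡ _))

    detK-swapRows : (∀ x → detK (setRows x x) ≡ 0#) → ∀ x y → detK (setRows x y) + detK (setRows y x) ≡ 0#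
    detK-swapRows equal⇒0 x y = begin
      detK (setRows x y) + detK (setRows y x)
        ≡⟨ solve 2 (λ s t → s :+ t := con (ℤ.+ 0) :+ s :+ (t :+ con (ℤ.+ 0))) refl _ _ ⟩
      0# + detK (setRows x y) + (detK (setRows y x) + 0#)
        ≡⟨ cong₂ (λ s t → s + detK (setRows x y) + (detK (setRows y x) + t)) (sym (equal⇒0 x)) (sym (equal⇒0 y)) ⟩
      detK (setRows x x) + detK (setRows x y) + (detK (setRows y x) + detK (setRows y y))
        ≡⟨ sym (cong₂ _+_ (additiveʳ x x y) (additiveʳ y x y)) ⟩
      detK (setRows x (x ⊕ y)) + detK (setRows y (x ⊕ y))
        ≡⟨ sym (additiveˡ x y (x ⊕ y)) ⟩
      detK (setRows (x ⊕ y) (x ⊕ y))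
        ≡⟨ equal⇒0 (x ⊕ y) ⟩
      0# ∎

    setRows-self : ∀ r c → M r c ≡ setRows (M a) (M b) r c
    setRows-self r c with r Fin.≟ b | r Fin.≟ a
    ... | yes refl | _        = sym (setRows-b (M a) (M r) c)
    ... | no  _    | yes refl = sym (setRows-a (M r) (M b) c)
    ... | no  r≢b  | no  r≢a  = sym (trans (setRow-≢ _ b (M b) r≢b c) (setRow-≢ M a (M a) r≢a c))

    setRows-others : ∀ x y r → r ≢ a → r ≢ b → ∀ c → setRows x y r c ≡ M r c
    setRows-others x y r r≢a r≢b c = trans (setRow-≢ _ b y r≢b c) (setRow-≢ M a x r≢a c)

  detK-equalRows₀ : ∀ {k} → Alternating k → ∀ (M : Mat (suc k)) s → (∀ c → M zero c ≡ M (suc s) c) → detK M ≡ 0#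
  detK-equalRows₀ alternating M zero    row₀≡row₁ = detK-equalRows₀₁ M row₀≡row₁
  detK-equalRows₀ alternating M (suc s) row₀≡rowₛ = begin
    detK M                           ≡⟨ detK-cong M _ (setRows-self M a≢b) ⟩
    detK (setRows M a≢b (M a) (M b)) ≡⟨ x+y≡0⇒x≡-y (detK-swapRows M a≢b equal⇒0 (M a) (M b)) ⟩
    - detK swapped                   ≡⟨ cong -_ swapped≡0 ⟩
    - 0#                             ≡⟨ -0#≈0# ⟩
    0#                               ∎
    where
    a b : Fin (suc (suc _))
    a = suc zero
    b = suc (suc s)
    a≢b : a ≢ b
    a≢b ()
    equal⇒0 : ∀ x → detK (setRows M a≢b x x) ≡ 0#
    equal⇒0 x = alternating-suc alternating (setRows M a≢b x x) zero (suc s) (λ ())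
                  (λ c → trans (setRows-a M a≢b x x c) (sym (setRows-b M a≢b x x c)))
    swapped = setRows M a≢b (M b) (M a)
    swapped≡0 : detK swapped ≡ 0#
    swapped≡0 = detK-equalRows₀₁ swapped (λ c → trans (setRows-others M a≢b (M b) (M a) zero (λ ()) (λ ()) c)
                                               (trans (row₀≡rowₛ c) (sym (setRows-a M a≢b (M b) (M a) c))))

  detK-alternating : ∀ k → Alternating k
  detK-alternating (suc k) M zero    zero    r≢s rows≡ = ⊥-elim (r≢s refl)
  detK-alternating (suc k) M (suc r) (suc s) r≢s rows≡ = alternating-suc (detK-alternating k) M r s (r≢s ∘ cong suc) rows≡
  detK-alternating (suc k) M zero    (suc s) r≢s rows≡ = detK-equalRows₀ (detK-alternating k) M s rows≡
  detK-alternating (suc k) M (suc r) zero    r≢s rows≡ = detK-equalRows₀ (detK-alternating k) M r (sym ∘ rows≡)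

  addRow : ∀ {k} → Mat k → (r s : Fin k) → Carrier → Mat k
  addRow M r s t = setRow M s (λ c → M s c + t * M r c)

  addRow-≡ : ∀ {k} (M : Mat k) r s t c → addRow M r s t s c ≡ M s c + t * M r c
  addRow-≡ M r s t = setRow-≡ M s (λ c → M s c + t * M r c)

  addRow-≢ : ∀ {k} (M : Mat k) r s t {r′} → r′ ≢ s → ∀ c → addRow M r s t r′ c ≡ M r′ c
  addRow-≢ M r s t = setRow-≢ M s (λ c → M s c + t * M r c)

  detK-addRow : ∀ {k} (M : Mat k) {r s} → r ≢ s → ∀ t → detK (addRow M r s t) ≡ detK M
  detK-addRow M {r} {s} r≢s t = begin
    detK (addRow M r s t) ≡⟨ detK-linear s (addRow M r s t) M B t
                               (λ r′ r′≢s c → addRow-≢ M r s t r′≢s c)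
                               (λ r′ r′≢s c → trans (addRow-≢ M r s t r′≢s c) (sym (setRow-≢ M s (M r) r′≢s c)))
                               (λ c → trans (addRow-≡ M r s t c) (cong (λ z → M s c + t * z) (sym (setRow-≡ M s (M r) c)))) ⟩
    detK M + t * detK B   ≡⟨ cong (λ z → detK M + t * z) (detK-alternating _ B r s r≢s
                               (λ c → trans (setRow-≢ M s (M r) r≢s c) (sym (setRow-≡ M s (M r) c)))) ⟩
    detK M + t * 0#       ≡⟨ trans (cong (detK M +_) (zeroʳ t)) (+-identityʳ _) ⟩
    detK M                ∎
    where
    B = setRow M s (M r)

module Kernel (K : Field) (_≟_ : DecidableEquality (Field.Carrier K)) where
  open FieldProperties K
  open Determinant K
  open ≡-Reasoning

  apply : ∀ {k} → Mat k → (Fin k → Carrier) → Fin k → Carrier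
  apply M v r = ∑ (λ c → M r c * v c)

  InKernel : ∀ {k} → Mat k → (Fin k → Carrier) → Set
  InKernel M v = ∀ r → apply M v r ≡ 0#

  Nonzero : ∀ {k} → (Fin k → Carrier) → Set
  Nonzero v = ∃ λ i → v i ≢ 0#

  nonzero? : ∀ {k} (v : Fin k → Carrier) → Dec (Nonzero v)
  nonzero? v = Fin.any? (λ i → ¬? (v i ≟ 0#))

  ¬nonzero⇒zero : ∀ {k} (v : Fin k → Carrier) → ¬ Nonzero v → ∀ i → v i ≡ 0#
  ¬nonzero⇒zero v zero-v i with v i ≟ 0#
  ... | yes vᵢ≡0 = vᵢ≡0
  ... | no  vᵢ≢0 = ⊥-elim (zero-v (i , vᵢ≢0))

  apply-addRow : ∀ {k} (M : Mat k) r s t v → apply (addRow M r s t) v s ≡ apply M v s + t * apply M v r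
  apply-addRow M r s t v = begin
    ∑ (λ c → addRow M r s t s c * v c)        ≡⟨ ∑-cong (λ c → cong (_* v c) (addRow-≡ M r s t c)) ⟩
    ∑ (λ c → (M s c + t * M r c) * v c)       ≡⟨ ∑-cong (λ c → solve 4 (λ a t b x → (a :+ t :* b) :* x := a :* x :+ t :* (b :* x))
                                                                  refl (M s c) t (M r c) (v c)) ⟩
    ∑ (λ c → M s c * v c + t * (M r c * v c)) ≡⟨ ∑-distrib-+ (λ c → M s c * v c) (λ c → t * (M r c * v c)) ⟩
    apply M v s + ∑ (λ c → t * (M r c * v c)) ≡⟨ cong (apply M v s +_) (*-distribˡ-∑ t (λ c → M r c * v c)) ⟩
    apply M v s + t * apply M v r             ∎

  record RowEquivalent {k} (M M′ : Mat k) : Set where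
    field
      detK-eq  : detK M′ ≡ detK M
      kernel⇒ : ∀ v → InKernel M v → InKernel M′ v
      kernel⇐ : ∀ v → InKernel M′ v → InKernel M v

  rowEquivalent-refl : ∀ {k} (M : Mat k) → RowEquivalent M M
  rowEquivalent-refl M = record { detK-eq = refl ; kernel⇒ = λ _ Mv≡0 → Mv≡0 ; kernel⇐ = λ _ Mv≡0 → Mv≡0 }

  rowEquivalent-trans : ∀ {k} {M M′ M″ : Mat k} → RowEquivalent M M′ → RowEquivalent M′ M″ → RowEquivalent M M″
  rowEquivalent-trans M∼M′ M′∼M″ = record
    { detK-eq = trans (RowEquivalent.detK-eq M′∼M″) (RowEquivalent.detK-eq M∼M′)
    ; kernel⇒ = λ v → RowEquivalent.kernel⇒ M′∼M″ v ∘ RowEquivalent.kernel⇒ M∼M′ v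
    ; kernel⇐ = λ v → RowEquivalent.kernel⇐ M∼M′ v ∘ RowEquivalent.kernel⇐ M′∼M″ v }

  addRow-rowEquivalent : ∀ {k} (M : Mat k) {r s} → r ≢ s → ∀ t → RowEquivalent M (addRow M r s t)
  addRow-rowEquivalent M {r} {s} r≢s t = record
    { detK-eq = detK-addRow M r≢s t
    ; kernel⇒ = kernel⇒
    ; kernel⇐ = kernel⇐ }
    where
    unchanged : ∀ v r′ → r′ ≢ s → apply (addRow M r s t) v r′ ≡ apply M v r′
    unchanged v r′ r′≢s = ∑-cong (λ c → cong (_* v c) (addRow-≢ M r s t r′≢s c))
    kernel⇒ : ∀ v → InKernel M v → InKernel (addRow M r s t) v
    kernel⇒ v Mv≡0 r′ with r′ Fin.≟ s
    ... | yes refl = trans (apply-addRow M r s t v) (trans (cong₂ (λ x y → x + t * y) (Mv≡0 s) (Mv≡0 r))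
                       (solve 1 (λ t → con (ℤ.+ 0) :+ t :* con (ℤ.+ 0) := con (ℤ.+ 0)) refl t))
    ... | no r′≢s  = trans (unchanged v r′ r′≢s) (Mv≡0 r′)
    kernel⇐ : ∀ v → InKernel (addRow M r s t) v → InKernel M v
    kernel⇐ v M′v≡0 r′ with r′ Fin.≟ s
    ... | yes refl = begin
      apply M v s             ≡⟨ x+y≡0⇒x≡-y (trans (sym (apply-addRow M r s t v)) (M′v≡0 s)) ⟩
      - (t * apply M v r)     ≡⟨ cong (λ z → - (t * z)) (trans (sym (unchanged v r r≢s)) (M′v≡0 r)) ⟩
      - (t * 0#)              ≡⟨ solve 1 (λ t → :- (t :* con (ℤ.+ 0)) := con (ℤ.+ 0)) refl t ⟩
      0#                      ∎
    ... | no r′≢s  = trans (sym (unchanged v r′ r′≢s)) (M′v≡0 r′)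

  pivot : ∀ {k} (M : Mat (suc k)) r → M r zero ≢ 0# → Σ (Mat (suc k)) λ M′ → RowEquivalent M M′ × M′ zero zero ≢ 0#
  pivot M zero    M₀₀≢0 = M , rowEquivalent-refl M , M₀₀≢0
  pivot M (suc r) Mᵣ₀≢0 with M zero zero ≟ 0#
  ... | no  M₀₀≢0 = M , rowEquivalent-refl M , M₀₀≢0
  ... | yes M₀₀≡0 = addRow M (suc r) zero 1# , addRow-rowEquivalent M {suc r} {zero} (λ ()) 1# , λ M′₀₀≡0 → Mᵣ₀≢0 (begin
    M (suc r) zero                      ≡⟨ solve 1 (λ x → x := con (ℤ.+ 0) :+ con (ℤ.+ 1) :* x) refl _ ⟩
    0# + 1# * M (suc r) zero            ≡⟨ cong (_+ 1# * M (suc r) zero) (sym M₀₀≡0) ⟩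
    M zero zero + 1# * M (suc r) zero   ≡⟨ sym (addRow-≡ M (suc r) zero 1# zero) ⟩
    addRow M (suc r) zero 1# zero zero  ≡⟨ M′₀₀≡0 ⟩
    0#                                  ∎)

  record PartiallyCleared {k} (M : Mat (suc k)) (j : ℕ) : Set where
    field
      matrix     : Mat (suc k)
      equivalent : RowEquivalent M matrix
      row₀       : ∀ c → matrix zero c ≡ M zero c
      cleared    : ∀ s → toℕ s ℕ.< j → matrix (suc s) zero ≡ 0#

  clear : ∀ {k} (M : Mat (suc k)) p⁻¹ → M zero zero * p⁻¹ ≡ 1# → ∀ j → j ℕ.≤ k → PartiallyCleared M j
  clear M p⁻¹ pp⁻¹≡1 zero    _   = record
    { matrix = M ; equivalent = rowEquivalent-refl M ; row₀ = λ _ → refl ; cleared = λ _ () }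
  clear M p⁻¹ pp⁻¹≡1 (suc j) j<k = record
    { matrix     = addRow matrix zero (suc s) t
    ; equivalent = rowEquivalent-trans equivalent (addRow-rowEquivalent matrix {zero} {suc s} (λ ()) t)
    ; row₀       = λ c → trans (addRow-≢ matrix zero (suc s) t (λ ()) c) (row₀ c)
    ; cleared    = cleared′ }
    where
    open PartiallyCleared (clear M p⁻¹ pp⁻¹≡1 j (ℕ.<⇒≤ j<k))
    s = fromℕ< j<k
    a = matrix (suc s) zero
    t = - (a * p⁻¹)
    cleared′ : ∀ s′ → toℕ s′ ℕ.< suc j → addRow matrix zero (suc s) t (suc s′) zero ≡ 0#
    cleared′ s′ s′<1+j with s′ Fin.≟ s
    ... | yes refl = begin
      addRow matrix zero (suc s) t (suc s) zero     ≡⟨ addRow-≡ matrix zero (suc s) t zero ⟩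
      a + - (a * p⁻¹) * matrix zero zero            ≡⟨ cong (λ z → a + - (a * p⁻¹) * z) (row₀ zero) ⟩
      a + - (a * p⁻¹) * M zero zero                 ≡⟨ solve 3 (λ a i p → a :+ :- (a :* i) :* p := a :+ :- (a :* (p :* i))) refl a p⁻¹ _ ⟩
      a + - (a * (M zero zero * p⁻¹))               ≡⟨ cong (λ z → a + - (a * z)) pp⁻¹≡1 ⟩
      a + - (a * 1#)                                ≡⟨ solve 1 (λ a → a :+ :- (a :* con (ℤ.+ 1)) := con (ℤ.+ 0)) refl a ⟩
      0#                                            ∎
    ... | no s′≢s  = trans (addRow-≢ matrix zero (suc s) t (s′≢s ∘ Fin.suc-injective) zero)
                           (cleared s′ (ℕ.≤∧≢⇒< (ℕ.≤-pred s′<1+j) (s′≢s ∘ λ eq → Fin.toℕ-injective (trans eq (sym (Fin.toℕ-fromℕ< j<k))))))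

  record Reduction {k} (M : Mat (suc k)) : Set where
    field
      pivotEntry          : Carrier
      pivotEntry≢0        : pivotEntry ≢ 0#
      rest                : Mat k
      detK-split          : detK M ≡ pivotEntry * detK rest
      kernel-tail         : ∀ v → InKernel M v → InKernel rest (v ∘ suc)
      kernel-tail-nonzero : ∀ v → InKernel M v → Nonzero v → Nonzero (v ∘ suc)
      kernel-extend       : ∀ u → InKernel rest u → Σ (Fin (suc k) → Carrier) λ v → InKernel M v × (∀ c → v (suc c) ≡ u c)

  -- Gaussian elimination of the first column, with the minor of the pivot as `rest`.
  reduce : ∀ {k} (M : Mat (suc k)) r → M r zero ≢ 0# → Reduction M
  reduce {k} M r Mᵣ₀≢0 = record
    { pivotEntry          = p
    ; pivotEntry≢0        = p≢0
    ; rest                = B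
    ; detK-split          = trans (sym (RowEquivalent.detK-eq M∼E)) (trans (detK-expandColumn₀ E column₀) (cong (_* detK B) E₀₀≡p))
    ; kernel-tail         = λ v Mv≡0 s → trans (sym (apply-suc v s)) (RowEquivalent.kernel⇒ M∼E v Mv≡0 (suc s))
    ; kernel-tail-nonzero = tail-nonzero
    ; kernel-extend       = extend }
    where
    pivoted = pivot M r Mᵣ₀≢0
    P = proj₁ pivoted
    p = P zero zero
    p≢0 = proj₂ (proj₂ pivoted)
    p⁻¹ = proj₁ (inverse p p≢0)
    pp⁻¹≡1 = proj₂ (inverse p p≢0)
    open PartiallyCleared (clear P p⁻¹ pp⁻¹≡1 k ℕ.≤-refl) renaming (matrix to E)
    M∼E : RowEquivalent M E
    M∼E = rowEquivalent-trans (proj₁ (proj₂ pivoted)) equivalent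
    column₀ : ∀ s → E (suc s) zero ≡ 0#
    column₀ s = cleared s (Fin.toℕ<n s)
    B : Mat k
    B = minor E zero
    E₀₀≡p : E zero zero ≡ p
    E₀₀≡p = row₀ zero
    apply-suc : ∀ v s → apply E v (suc s) ≡ apply B (v ∘ suc) s
    apply-suc v s = trans (cong (λ z → z * v zero + apply B (v ∘ suc) s) (column₀ s))
                      (solve 2 (λ x y → con (ℤ.+ 0) :* x :+ y := y) refl (v zero) _)
    tail-nonzero : ∀ v → InKernel M v → Nonzero v → Nonzero (v ∘ suc)
    tail-nonzero v Mv≡0 (i , vᵢ≢0) with nonzero? (v ∘ suc)
    ... | yes tail≢0 = tail≢0
    ... | no  tail≡0 = ⊥-elim (vᵢ≢0 (all-zero i))
      where
      v₀≡0 : v zero ≡ 0#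
      v₀≡0 = x≢0∧x*y≡0⇒y≡0 p≢0 (begin
        p * v zero                                       ≡⟨ sym (+-identityʳ _) ⟩
        p * v zero + 0#                                  ≡⟨ cong₂ (λ x y → x * v zero + y) (sym E₀₀≡p)
                                                            (sym (∑-zero _ (λ c → trans (cong (E zero (suc c) *_) (¬nonzero⇒zero (v ∘ suc) tail≡0 c)) (zeroʳ _)))) ⟩
        apply E v zero                                   ≡⟨ RowEquivalent.kernel⇒ M∼E v Mv≡0 zero ⟩
        0#                                               ∎)
      all-zero : ∀ i → v i ≡ 0#
      all-zero zero    = v₀≡0
      all-zero (suc c) = ¬nonzero⇒zero (v ∘ suc) tail≡0 c
    extend : ∀ u → InKernel B u → Σ (Fin (suc k) → Carrier) λ v → InKernel M v × (∀ c → v (suc c) ≡ u c)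
    extend u Bu≡0 = v , RowEquivalent.kernel⇐ M∼E v Ev≡0 , (λ _ → refl)
      where
      S = ∑ (λ c → E zero (suc c) * u c)
      v : Fin (suc k) → Carrier
      v zero    = - (p⁻¹ * S)
      v (suc c) = u c
      Ev≡0 : InKernel E v
      Ev≡0 zero = begin
        E zero zero * - (p⁻¹ * S) + S ≡⟨ cong (λ z → z * - (p⁻¹ * S) + S) E₀₀≡p ⟩
        p * - (p⁻¹ * S) + S           ≡⟨ solve 3 (λ p i s → p :* :- (i :* s) :+ s := :- ((p :* i) :* s) :+ s) refl p p⁻¹ S ⟩
        - ((p * p⁻¹) * S) + S         ≡⟨ cong (λ z → - (z * S) + S) pp⁻¹≡1 ⟩
        - (1# * S) + S                ≡⟨ solve 1 (λ s → :- (con (ℤ.+ 1) :* s) :+ s := con (ℤ.+ 0)) refl S ⟩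
        0#                            ∎
      Ev≡0 (suc s) = trans (apply-suc v s) (Bu≡0 s)

  firstColumn? : ∀ {k} (M : Mat (suc k)) → Dec (∃ λ r → M r zero ≢ 0#)
  firstColumn? M = Fin.any? (λ r → ¬? (M r zero ≟ 0#))

  kernel⇒detK≡0 : ∀ {k} (M : Mat k) v → Nonzero v → InKernel M v → detK M ≡ 0#
  kernel⇒detK≡0 {suc k} M v v≢0 Mv≡0 with firstColumn? M
  ... | no  column≡0     = detK-zeroColumn M zero (¬nonzero⇒zero (λ r → M r zero) column≡0)
  ... | yes (r , Mᵣ₀≢0) = begin
    detK M                 ≡⟨ detK-split ⟩
    pivotEntry * detK rest ≡⟨ cong (pivotEntry *_) (kernel⇒detK≡0 rest (v ∘ suc) (kernel-tail-nonzero v Mv≡0 v≢0) (kernel-tail v Mv≡0)) ⟩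
    pivotEntry * 0#        ≡⟨ zeroʳ _ ⟩
    0#                     ∎
    where open Reduction (reduce M r Mᵣ₀≢0)

  detK≡0⇒kernel : ∀ {k} (M : Mat k) → detK M ≡ 0# → Σ (Fin k → Carrier) λ v → Nonzero v × InKernel M v
  detK≡0⇒kernel {zero}  M 1≡0 = ⊥-elim (0≢1 (sym 1≡0))
  detK≡0⇒kernel {suc k} M detK≡0 with firstColumn? M
  ... | no  column≡0     = e₀ , (zero , λ 1≡0 → 0≢1 (sym 1≡0)) , λ r →
    trans (cong₂ _+_ (trans (*-identityʳ _) (¬nonzero⇒zero (λ r → M r zero) column≡0 r))
                     (∑-zero (λ c → M r (suc c) * e₀ (suc c)) (λ c → zeroʳ _)))
          (+-identityˡ 0#)
    where
    e₀ : Fin (suc k) → Carrier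
    e₀ zero    = 1#
    e₀ (suc _) = 0#
  ... | yes (r , Mᵣ₀≢0) with detK≡0⇒kernel rest (x≢0∧x*y≡0⇒y≡0 pivotEntry≢0 (trans (sym detK-split) detK≡0))
    where open Reduction (reduce M r Mᵣ₀≢0)
  ...   | u , (i , uᵢ≢0) , rest-u≡0 with Reduction.kernel-extend (reduce M r Mᵣ₀≢0) u rest-u≡0
  ...     | v , Mv≡0 , v∘suc≡u = v , (suc i , λ vᵢ≡0 → uᵢ≢0 (trans (sym (v∘suc≡u i)) vᵢ≡0)) , Mv≡0

module CyclicIndex (K : Field) (n : ℕ) {{n≢0 : NonZero n}} where
  open FieldProperties K
  open ≡-Reasoning

  ∑ℕ : ℕ → (ℕ → Carrier) → Carrier
  ∑ℕ m g = ∑ {m} (g ∘ toℕ)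

  ∑ℕ-cong : ∀ m {f g : ℕ → Carrier} → (∀ i → i ℕ.< m → f i ≡ g i) → ∑ℕ m f ≡ ∑ℕ m g
  ∑ℕ-cong m f≗g = ∑-cong (λ i → f≗g (toℕ i) (Fin.toℕ<n i))

  ∑ℕ-last : ∀ m g → ∑ℕ (suc m) g ≡ ∑ℕ m g + g m
  ∑ℕ-last zero    g = trans (+-identityʳ _) (sym (+-identityˡ _))
  ∑ℕ-last (suc m) g = trans (cong (g 0 +_) (∑ℕ-last m (g ∘ suc))) (sym (+-assoc _ _ _))

  ∑ℕ-shift : ∀ (g : ℕ → Carrier) → g n ≡ g 0 → ∑ℕ n (g ∘ suc) ≡ ∑ℕ n g
  ∑ℕ-shift g gₙ≡g₀ = begin
    ∑ℕ n (g ∘ suc)                  ≡⟨ solve 2 (λ a b → a := a :+ b :+ :- b) refl _ (g 0) ⟩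
    ∑ℕ n (g ∘ suc) + g 0 + - g 0    ≡⟨ cong (_+ - g 0) (trans (+-comm _ _) (∑ℕ-last n g)) ⟩
    ∑ℕ n g + g n + - g 0            ≡⟨ cong (λ z → ∑ℕ n g + z + - g 0) gₙ≡g₀ ⟩
    ∑ℕ n g + g 0 + - g 0            ≡⟨ solve 2 (λ a b → a :+ b :+ :- b := a) refl _ (g 0) ⟩
    ∑ℕ n g                          ∎

  ∑ℕ-rotate : ∀ s (g : ℕ → Carrier) → ∑ℕ n (λ i → g ((i ℕ.+ s) % n)) ≡ ∑ℕ n g
  ∑ℕ-rotate zero    g = ∑ℕ-cong n (λ i i<n → cong g (trans (cong (_% n) (ℕ.+-identityʳ i)) (m<n⇒m%n≡m i<n)))
  ∑ℕ-rotate (suc s) g = begin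
    ∑ℕ n (λ i → g ((i ℕ.+ suc s) % n))   ≡⟨ ∑ℕ-cong n (λ i _ → cong (λ k → g (k % n)) (ℕ.+-suc i s)) ⟩
    ∑ℕ n (λ i → g ((suc i ℕ.+ s) % n))   ≡⟨ ∑ℕ-shift (λ i → g ((i ℕ.+ s) % n)) (cong g (trans (cong (_% n) (ℕ.+-comm n s)) ([m+n]%n≡m%n s n))) ⟩
    ∑ℕ n (λ i → g ((i ℕ.+ s) % n))       ≡⟨ ∑ℕ-rotate s g ⟩
    ∑ℕ n g                               ∎

  %-+ˡ : ∀ a b → ((a % n) ℕ.+ b) % n ≡ (a ℕ.+ b) % n
  %-+ˡ a b = trans (%-distribˡ-+ (a % n) b n) (trans (cong (λ z → (z ℕ.+ b % n) % n) (m%n%n≡m%n a n)) (sym (%-distribˡ-+ a b n)))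

  %-+ʳ : ∀ a b → (a ℕ.+ b % n) % n ≡ (a ℕ.+ b) % n
  %-+ʳ a b = trans (cong (_% n) (ℕ.+-comm a (b % n))) (trans (%-+ˡ b a) (cong (_% n) (ℕ.+-comm b a)))

  cycIdx≡ : ∀ i j → i ℕ.< n → j ℕ.< n → cycIdx K n i j ≡ (i ℕ.+ (n ℕ.∸ j)) % n
  cycIdx≡ i j i<n j<n with j ℕ.≤ᵇ i in j≤ᵇi
  ... | true = sym (begin
    (i ℕ.+ (n ℕ.∸ j)) % n        ≡⟨ cong (_% n) shuffle ⟩
    (i ℕ.∸ j ℕ.+ n) % n          ≡⟨ [m+n]%n≡m%n (i ℕ.∸ j) n ⟩
    (i ℕ.∸ j) % n                ≡⟨ m<n⇒m%n≡m (ℕ.≤-<-trans (ℕ.m∸n≤m i j) i<n) ⟩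
    i ℕ.∸ j                      ∎)
    where
    j≤i : j ℕ.≤ i
    j≤i = ℕ.≤ᵇ⇒≤ j i (subst T (sym j≤ᵇi) tt)
    shuffle : i ℕ.+ (n ℕ.∸ j) ≡ i ℕ.∸ j ℕ.+ n
    shuffle = trans (cong (ℕ._+ (n ℕ.∸ j)) (sym (ℕ.m∸n+n≡m j≤i)))
                (trans (ℕ.+-assoc (i ℕ.∸ j) j (n ℕ.∸ j)) (cong (i ℕ.∸ j ℕ.+_) (ℕ.m+[n∸m]≡n (ℕ.<⇒≤ j<n))))
  ... | false = trans (ℕ.+-∸-comm i (ℕ.<⇒≤ j<n)) (trans (ℕ.+-comm (n ℕ.∸ j) i) (sym (m<n⇒m%n≡m small)))
    where
    i<j : i ℕ.< j
    i<j = ℕ.≰⇒> (λ j≤i → subst T j≤ᵇi (ℕ.≤⇒≤ᵇ j≤i))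
    small : i ℕ.+ (n ℕ.∸ j) ℕ.< n
    small = subst (i ℕ.+ (n ℕ.∸ j) ℕ.<_) (ℕ.m+[n∸m]≡n (ℕ.<⇒≤ j<n)) (ℕ.+-monoˡ-< (n ℕ.∸ j) i<j)

  [cycIdx+j]%n≡i : ∀ i j → i ℕ.< n → j ℕ.< n → (cycIdx K n i j ℕ.+ j) % n ≡ i
  [cycIdx+j]%n≡i i j i<n j<n = begin
    (cycIdx K n i j ℕ.+ j) % n               ≡⟨ cong (λ z → (z ℕ.+ j) % n) (cycIdx≡ i j i<n j<n) ⟩
    ((i ℕ.+ (n ℕ.∸ j)) % n ℕ.+ j) % n        ≡⟨ %-+ˡ _ j ⟩
    (i ℕ.+ (n ℕ.∸ j) ℕ.+ j) % n              ≡⟨ cong (_% n) (trans (ℕ.+-assoc i _ j) (cong (i ℕ.+_) (ℕ.m∸n+n≡m (ℕ.<⇒≤ j<n)))) ⟩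
    (i ℕ.+ n) % n                            ≡⟨ [m+n]%n≡m%n i n ⟩
    i % n                                    ≡⟨ m<n⇒m%n≡m i<n ⟩
    i                                        ∎

  neg : ℕ → ℕ
  neg u = (n ℕ.∸ u) % n

  neg<n : ∀ u → neg u ℕ.< n
  neg<n u = m%n<n (n ℕ.∸ u) n

  cycIdx-neg : ∀ l m → l ℕ.< n → m ℕ.< n → cycIdx K n l (neg m) ≡ (m ℕ.+ l) % n
  cycIdx-neg l m l<n m<n = trans (cycIdx≡ l _ l<n (neg<n m)) (cancel m m<n)
    where
    cancel : ∀ m → m ℕ.< n → (l ℕ.+ (n ℕ.∸ neg m)) % n ≡ (m ℕ.+ l) % n
    cancel zero    _   = trans (cong (λ z → (l ℕ.+ (n ℕ.∸ z)) % n) (n%n≡0 n)) ([m+n]%n≡m%n l n)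
    cancel (suc m) m<n = trans (cong (λ z → (l ℕ.+ (n ℕ.∸ z)) % n) (m<n⇒m%n≡m (ℕ.∸-monoʳ-< {n} {suc m} {0} (s≤s z≤n) (ℕ.<⇒≤ m<n))))
                           (trans (cong (λ z → (l ℕ.+ z) % n) (ℕ.m∸[m∸n]≡n (ℕ.<⇒≤ m<n))) (cong (_% n) (ℕ.+-comm l (suc m))))

  [neg-u+[m+u]]%n≡m%n : ∀ u m → u ℕ.< n → (neg u ℕ.+ (m ℕ.+ u) % n) % n ≡ m % n
  [neg-u+[m+u]]%n≡m%n u m u<n = begin
    (neg u ℕ.+ (m ℕ.+ u) % n) % n            ≡⟨ %-+ʳ (neg u) (m ℕ.+ u) ⟩
    (neg u ℕ.+ (m ℕ.+ u)) % n                ≡⟨ %-+ˡ (n ℕ.∸ u) (m ℕ.+ u) ⟩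
    (n ℕ.∸ u ℕ.+ (m ℕ.+ u)) % n              ≡⟨ cong (_% n) shuffle ⟩
    (m ℕ.+ n) % n                            ≡⟨ [m+n]%n≡m%n m n ⟩
    m % n                                    ∎
    where
    shuffle : n ℕ.∸ u ℕ.+ (m ℕ.+ u) ≡ m ℕ.+ n
    shuffle = trans (cong (n ℕ.∸ u ℕ.+_) (ℕ.+-comm m u))
                (trans (sym (ℕ.+-assoc (n ℕ.∸ u) u m)) (trans (cong (ℕ._+ m) (ℕ.m∸n+n≡m (ℕ.<⇒≤ u<n))) (ℕ.+-comm n m)))

  neg-injective : ∀ u u′ → u ℕ.< n → u′ ℕ.< n → neg u ≡ neg u′ → u ≡ u′
  neg-injective u u′ u<n u′<n negu≡negu′ = begin
    u                                  ≡⟨ sym (cancel u′ u u′<n u<n) ⟩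
    (neg u′ ℕ.+ (u′ ℕ.+ u)) % n        ≡⟨ cong₂ (λ z w → (z ℕ.+ w) % n) (sym negu≡negu′) (ℕ.+-comm u′ u) ⟩
    (neg u ℕ.+ (u ℕ.+ u′)) % n         ≡⟨ cancel u u′ u<n u′<n ⟩
    u′                                 ∎
    where
    cancel : ∀ u u′ → u ℕ.< n → u′ ℕ.< n → (neg u ℕ.+ (u ℕ.+ u′)) % n ≡ u′
    cancel u u′ u<n u′<n = begin
      (neg u ℕ.+ (u ℕ.+ u′)) % n         ≡⟨ %-+ˡ (n ℕ.∸ u) (u ℕ.+ u′) ⟩
      (n ℕ.∸ u ℕ.+ (u ℕ.+ u′)) % n       ≡⟨ cong (_% n) (trans (sym (ℕ.+-assoc (n ℕ.∸ u) u u′)) (cong (ℕ._+ u′) (ℕ.m∸n+n≡m (ℕ.<⇒≤ u<n)))) ⟩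
      (n ℕ.+ u′) % n                     ≡⟨ cong (_% n) (ℕ.+-comm n u′) ⟩
      (u′ ℕ.+ n) % n                     ≡⟨ [m+n]%n≡m%n u′ n ⟩
      u′ % n                             ≡⟨ m<n⇒m%n≡m u′<n ⟩
      u′                                 ∎

module DicksonCriterion (K : Field) {q n : ℕ} (q-primePower : IsPrimePower q)
                        (card : Field.Carrier K ↔ Fin (q ℕ.^ n)) {{n≢0 : NonZero n}} where
  open FieldProperties K
  open FiniteField K card
  open FrobeniusPowers K {n = n} q-primePower card
  open CyclicIndex K n
  open Determinant K
  open Kernel K _≟_
  open ≡-Reasoning

  0<n : 0 ℕ.< n
  0<n = ℕ.>-nonZero⁻¹ n

  first : Fin n
  first = fromℕ< 0<n

  module _ (C : ℕ → Carrier) where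

    dicksonEntry : ℕ → ℕ → Carrier
    dicksonEntry j i = frob j (C (cycIdx K n i j))

    dicksonK : Mat n
    dicksonK j i = dicksonEntry (toℕ j) (toℕ i)

    linearized : Carrier → Carrier
    linearized y = ∑ℕ n (λ l → C l * frob l y)

    -- Row j of the Dickson matrix is row 0 twisted by frob j, so it sends (y^(q^i))ᵢ to L(y)^(q^j).
    dicksonK-apply : ∀ y (j : Fin n) → apply dicksonK (λ i → frob (toℕ i) y) j ≡ frob (toℕ j) (linearized y)
    dicksonK-apply y j = begin
      ∑ℕ n (λ i → dicksonEntry j′ i * frob i y)      ≡⟨ ∑ℕ-cong n rotated ⟩
      ∑ℕ n (λ i → G ((i ℕ.+ (n ℕ.∸ j′)) % n))        ≡⟨ ∑ℕ-rotate (n ℕ.∸ j′) G ⟩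
      ∑ℕ n G                                         ≡⟨ ∑-cong {n} (λ l → trans (cong (frob j′ (C (toℕ l)) *_) (sym (frob-frob j′ (toℕ l) y)))
                                                                           (sym (frob-* j′ (C (toℕ l)) (frob (toℕ l) y)))) ⟩
      ∑ℕ n (λ l → frob j′ (C l * frob l y))          ≡⟨ sym (frob-∑ j′ {n} (λ l → C (toℕ l) * frob (toℕ l) y)) ⟩
      frob j′ (linearized y)                         ∎
      where
      j′ = toℕ j
      j<n = Fin.toℕ<n j
      G : ℕ → Carrier
      G l = frob j′ (C l) * frob (l ℕ.+ j′) y
      rotated : ∀ i → i ℕ.< n → dicksonEntry j′ i * frob i y ≡ G ((i ℕ.+ (n ℕ.∸ j′)) % n)
      rotated i i<n = begin
        frob j′ (C (cycIdx K n i j′)) * frob i y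
          ≡⟨ cong (frob j′ (C (cycIdx K n i j′)) *_) (frob-cong-% i _ y (trans (m<n⇒m%n≡m i<n) (sym ([cycIdx+j]%n≡i i j′ i<n j<n)))) ⟩
        frob j′ (C (cycIdx K n i j′)) * frob (cycIdx K n i j′ ℕ.+ j′) y
          ≡⟨ cong G (cycIdx≡ i j′ i<n j<n) ⟩
        G ((i ℕ.+ (n ℕ.∸ j′)) % n)
          ∎

    root⇒detK≡0 : ∀ y → y ≢ 0# → linearized y ≡ 0# → detK dicksonK ≡ 0#
    root⇒detK≡0 y y≢0 L[y]≡0 = kernel⇒detK≡0 dicksonK (λ i → frob (toℕ i) y)
      (first , subst (λ m → frob m y ≢ 0#) (sym (Fin.toℕ-fromℕ< 0<n)) (subst (_≢ 0#) (sym (frob-zero y)) y≢0))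
      (λ j → trans (dicksonK-apply y j) (trans (cong (frob (toℕ j)) L[y]≡0) (frob-0 (toℕ j))))

    -- A kernel vector v yields, for every z, the root ∑ᵤ (z vᵤ)^(q^(-u)) of the linearized polynomial.
    module _ (v : Fin n → Carrier) (v-kernel : InKernel dicksonK v) where

      private
        V : ℕ → Carrier
        V = at K v

        row≡0 : ∀ j → j ℕ.< n → ∑ℕ n (λ l → dicksonEntry j l * V l) ≡ 0#
        row≡0 j j<n = trans (∑-cong {n} (λ c → cong₂ _*_ (cong (λ t → dicksonEntry t (toℕ c)) (sym (Fin.toℕ-fromℕ< j<n))) (at-toℕ v c)))
                            (v-kernel (fromℕ< j<n))

      kernelRoot : Carrier → Carrier
      kernelRoot z = ∑ℕ n (λ u → frob (neg u) (z * V u))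

      private
        H : Carrier → ℕ → ℕ → Carrier
        H z u i = C i * frob (neg u ℕ.+ i) (z * V u)

        expand : ∀ z i → C i * frob i (kernelRoot z) ≡ ∑ℕ n (λ u → H z u i)
        expand z i = begin
          C i * frob i (kernelRoot z)                            ≡⟨ cong (C i *_) (trans (frob-∑ i {n} (λ u → frob (neg (toℕ u)) (z * V (toℕ u))))
                                                                                         (∑-cong {n} (λ u → frob-frob i (neg (toℕ u)) _))) ⟩
          C i * ∑ℕ n (λ u → frob (neg u ℕ.+ i) (z * V u))        ≡⟨ sym (*-distribˡ-∑ {n} (C i) (λ u → frob (neg (toℕ u) ℕ.+ i) (z * V (toℕ u)))) ⟩
          ∑ℕ n (λ u → H z u i)                                   ∎

        rotate : ∀ z u → u ℕ.< n → ∑ℕ n (λ i → H z u i) ≡ ∑ℕ n (λ m → C ((m ℕ.+ u) % n) * frob m (z * V u))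
        rotate z u u<n = trans (sym (∑ℕ-rotate u (H z u)))
          (∑ℕ-cong n (λ m _ → cong (C ((m ℕ.+ u) % n) *_) (frob-cong-% _ m _ ([neg-u+[m+u]]%n≡m%n u m u<n))))

        twist : ∀ z m → m ℕ.< n → ∑ℕ n (λ u → C ((m ℕ.+ u) % n) * frob m (z * V u)) ≡ 0#
        twist z m m<n = begin
          ∑ℕ n (λ u → C ((m ℕ.+ u) % n) * frob m (z * V u))    ≡⟨ ∑ℕ-cong n entry ⟩
          ∑ℕ n (λ u → frob m (z * (dicksonEntry (neg m) u * V u)))
                                                               ≡⟨ sym (frob-∑ m {n} (λ u → z * (dicksonEntry (neg m) (toℕ u) * V (toℕ u)))) ⟩
          frob m (∑ℕ n (λ u → z * (dicksonEntry (neg m) u * V u)))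
                                                               ≡⟨ cong (frob m) (*-distribˡ-∑ {n} z (λ u → dicksonEntry (neg m) (toℕ u) * V (toℕ u))) ⟩
          frob m (z * ∑ℕ n (λ u → dicksonEntry (neg m) u * V u)) ≡⟨ cong (λ t → frob m (z * t)) (row≡0 (neg m) (neg<n m)) ⟩
          frob m (z * 0#)                                      ≡⟨ trans (cong (frob m) (zeroʳ z)) (frob-0 m) ⟩
          0#                                                   ∎
          where
          entry : ∀ u → u ℕ.< n → C ((m ℕ.+ u) % n) * frob m (z * V u) ≡ frob m (z * (dicksonEntry (neg m) u * V u))
          entry u u<n = begin
            C ((m ℕ.+ u) % n) * frob m (z * V u)                       ≡⟨ cong (_* frob m (z * V u)) (sym (frob-inverse m _ (ℕ.<⇒≤ m<n))) ⟩
            frob m (frob (n ℕ.∸ m) (C ((m ℕ.+ u) % n))) * frob m (z * V u) ≡⟨ sym (frob-* m _ _) ⟩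
            frob m (frob (n ℕ.∸ m) (C ((m ℕ.+ u) % n)) * (z * V u))    ≡⟨ cong (λ t → frob m (t * (z * V u))) untwist ⟩
            frob m (dicksonEntry (neg m) u * (z * V u))                ≡⟨ cong (frob m) (solve 3 (λ d z w → d :* (z :* w) := z :* (d :* w)) refl _ z (V u)) ⟩
            frob m (z * (dicksonEntry (neg m) u * V u))                ∎
            where
            untwist : frob (n ℕ.∸ m) (C ((m ℕ.+ u) % n)) ≡ dicksonEntry (neg m) u
            untwist = trans (frob-% (n ℕ.∸ m) _) (cong (frob (neg m) ∘ C) (sym (cycIdx-neg u m u<n m<n)))

      linearized-kernelRoot : ∀ z → linearized (kernelRoot z) ≡ 0#
      linearized-kernelRoot z = begin
        linearized (kernelRoot z)                                      ≡⟨ ∑-cong {n} (λ i → expand z (toℕ i)) ⟩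
        ∑ℕ n (λ i → ∑ℕ n (λ u → H z u i))                              ≡⟨ ∑-comm {n} {n} (λ i u → H z (toℕ u) (toℕ i)) ⟩
        ∑ℕ n (λ u → ∑ℕ n (λ i → H z u i))                              ≡⟨ ∑ℕ-cong n (rotate z) ⟩
        ∑ℕ n (λ u → ∑ℕ n (λ m → C ((m ℕ.+ u) % n) * frob m (z * V u)))
                                                                       ≡⟨ ∑-comm {n} {n} (λ u m → C ((toℕ m ℕ.+ toℕ u) % n) * frob (toℕ m) (z * V (toℕ u))) ⟩
        ∑ℕ n (λ m → ∑ℕ n (λ u → C ((m ℕ.+ u) % n) * frob m (z * V u))) ≡⟨ ∑ℕ-cong n (twist z) ⟩
        ∑ℕ n (λ m → 0#)                                                ≡⟨ ∑-zero {n} (λ _ → 0#) (λ _ → refl) ⟩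
        0#                                                             ∎

      -- As a polynomial in z, kernelRoot has the distinct exponents q^(-u) < q^n.
      kernelRoot-nonvanishing : Nonzero v → ∃ λ z → kernelRoot z ≢ 0#
      kernelRoot-nonvanishing (u₀ , v₀≢0) with sparse-nonvanishing d E E<N E-injective u₀ d₀≢0
        where
        d : Fin n → Carrier
        d u = frob (neg (toℕ u)) (v u)
        E : Fin n → ℕ
        E u = q ℕ.^ neg (toℕ u)
        E<N : ∀ u → E u ℕ.< q ℕ.^ n
        E<N u = ℕ.^-monoʳ-< q 1<q (neg<n (toℕ u))
        E-injective : ∀ u u′ → E u ≡ E u′ → u ≡ u′
        E-injective u u′ Eu≡Eu′ = Fin.toℕ-injective (neg-injective (toℕ u) (toℕ u′) (Fin.toℕ<n u) (Fin.toℕ<n u′) (^-injective _ _ Eu≡Eu′))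
        d₀≢0 : d u₀ ≢ 0#
        d₀≢0 = frob-≢0 (neg (toℕ u₀)) v₀≢0
      ... | z , value≢0 = z , λ root≡0 → value≢0 (trans (∑-cong {n} (λ u → trans (*-comm _ _)
                                  (trans (sym (frob-* (neg (toℕ u)) z (v u))) (cong (λ t → frob (neg (toℕ u)) (z * t)) (sym (at-toℕ v u))))))
                                  root≡0)

    detK≡0⇒root : detK dicksonK ≡ 0# → ∃ λ y → y ≢ 0# × linearized y ≡ 0#
    detK≡0⇒root detK≡0 with detK≡0⇒kernel dicksonK detK≡0
    ... | v , v≢0 , v-kernel with kernelRoot-nonvanishing v v-kernel v≢0
    ...   | z , root≢0 = kernelRoot v v-kernel z , root≢0 , linearized-kernelRoot v v-kernel z

module LinearSetInclusion (K : Field) {q n : ℕ} (q-primePower : IsPrimePower q) (2≤n : 2 ℕ.≤ n)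
                          (card : Field.Carrier K ↔ Fin (q ℕ.^ n)) (a b : Fin n → Field.Carrier K) where
  instance
    n≢0 : NonZero n
    n≢0 = ℕ.>-nonZero (ℕ.<-trans (s≤s z≤n) 2≤n)

  open FieldProperties K
  open PolynomialProperties K
  open FiniteField K card
  open FrobeniusPowers K {n = n} q-primePower card
  open CyclicIndex K n
  open Determinant K
  open DicksonCriterion K {n = n} q-primePower card
  open ≡-Reasoning

  f g : Carrier → Carrier
  f = qPolyEval K q a
  g = qPolyEval K q b

  coeffFAt : Carrier → ℕ → Carrier
  coeffFAt x l = eval (coeffF K q a b l) x

  eval-detDicksonF : ∀ x → eval (detDicksonF K q n a b) x ≡ detK (dicksonK (coeffFAt x))
  eval-detDicksonF x = trans (eval-det (dickson K q n (coeffF K q a b)) x)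
    (detK-cong {n} _ _ (λ j i → eval-powP (coeffF K q a b (cycIdx K n (toℕ i) (toℕ j))) (q ℕ.^ toℕ j) x))

  eval-qPolyAsPoly : ∀ (c : Fin n → Carrier) z → eval (qPolyAsPoly K q c) z ≡ qPolyEval K q c z
  eval-qPolyAsPoly c z = trans (eval-sumFinP {n} _ z)
    (∑-cong {n} (λ i → trans (eval-scaleP (c i) (powP K (X K) (q ℕ.^ toℕ i)) z) (cong (c i *_) (eval-powP-X (q ℕ.^ toℕ i) z))))

  linearized-coeffFAt : ∀ x y → linearized (coeffFAt x) y ≡ f x * y + - (x * g y)
  linearized-coeffFAt x y = begin
    ∑ℕ n (λ l → coeffFAt x l * frob l y)                  ≡⟨ ∑-cong {n} (λ i → term (toℕ i)) ⟩
    ∑ℕ n (λ l → leading l + - (x * (at K b l * frob l y))) ≡⟨ ∑-distrib-+ {n} (leading ∘ toℕ) _ ⟩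
    ∑ℕ n leading + ∑ℕ n (λ l → - (x * (at K b l * frob l y)))
                                                          ≡⟨ cong₂ _+_ sum-leading (trans (-‿distrib-∑ {n} _) (cong -_ (*-distribˡ-∑ {n} x _))) ⟩
    f x * y + - (x * ∑ℕ n (λ l → at K b l * frob l y))    ≡⟨ cong (λ t → f x * y + - (x * t))
                                                                (∑-cong {n} (λ i → cong (_* frob (toℕ i) y) (at-toℕ b i))) ⟩
    f x * y + - (x * g y)                                 ∎
    where
    leading : ℕ → Carrier
    leading zero    = f x * frob 0 y
    leading (suc _) = 0#
    term : ∀ l → coeffFAt x l * frob l y ≡ leading l + - (x * (at K b l * frob l y))
    term zero = begin
      eval (subP K (qPolyAsPoly K q a) (scaleP K (at K b 0) (X K))) x * frob 0 y
        ≡⟨ cong (_* frob 0 y) (trans (eval-subP (qPolyAsPoly K q a) _ x)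
             (cong₂ (λ s t → s + - t) (eval-qPolyAsPoly a x) (trans (eval-scaleP _ (X K) x) (cong (at K b 0 *_) (eval-X x))))) ⟩
      (f x + - (at K b 0 * x)) * frob 0 y
        ≡⟨ solve 4 (λ F B X Y → (F :+ :- (B :* X)) :* Y := F :* Y :+ :- (X :* (B :* Y))) refl (f x) (at K b 0) x (frob 0 y) ⟩
      f x * frob 0 y + - (x * (at K b 0 * frob 0 y))
        ∎
    term (suc l) = begin
      eval (negP K (scaleP K (at K b (suc l)) (X K))) x * frob (suc l) y
        ≡⟨ cong (_* frob (suc l) y) (trans (eval-negP (scaleP K (at K b (suc l)) (X K)) x)
             (cong -_ (trans (eval-scaleP _ (X K) x) (cong (at K b (suc l) *_) (eval-X x))))) ⟩
      - (at K b (suc l) * x) * frob (suc l) y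
        ≡⟨ solve 3 (λ B X Y → :- (B :* X) :* Y := con (ℤ.+ 0) :+ :- (X :* (B :* Y))) refl (at K b (suc l)) x (frob (suc l) y) ⟩
      0# + - (x * (at K b (suc l) * frob (suc l) y))
        ∎
    sum-leading : ∑ℕ n leading ≡ f x * y
    sum-leading = trans (∑-single (leading ∘ toℕ) first others)
                    (trans (cong leading (Fin.toℕ-fromℕ< 0<n)) (cong (f x *_) (frob-zero y)))
      where
      others : ∀ i → i ≢ first → leading (toℕ i) ≡ 0#
      others i i≢first with toℕ i in eq
      ... | zero  = ⊥-elim (i≢first (Fin.toℕ-injective (trans eq (sym (Fin.toℕ-fromℕ< 0<n)))))
      ... | suc _ = refl

  f0≡0 : f 0# ≡ 0#
  f0≡0 = ∑-zero {n} _ (λ i → trans (cong (a i *_) (frob-0 (toℕ i))) (zeroʳ _))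

  -- ⟨(x, f x)⟩ = ⟨(y, g y)⟩ with y ≠ 0 says exactly that y is a nonzero root of F at x.
  inclusion⇒detDicksonF-vanishes : LinSetSubset K f g → ∀ x → eval (detDicksonF K q n a b) x ≡ 0#
  inclusion⇒detDicksonF-vanishes L⊆ x = trans (eval-detDicksonF x) (root⇒detK≡0 (coeffFAt x) y y≢0 (trans (linearized-coeffFAt x y) F[y]≡0))
    where
    witness : Σ Carrier λ y → y ≢ 0# × f x * y + - (x * g y) ≡ 0#
    witness with x ≟ 0#
    ... | yes x≡0 = 1# , (λ 1≡0 → 0≢1 (sym 1≡0)) , (begin
      f x * 1# + - (x * g 1#)    ≡⟨ cong (λ t → f t * 1# + - (t * g 1#)) x≡0 ⟩
      f 0# * 1# + - (0# * g 1#)  ≡⟨ cong (λ t → t * 1# + - (0# * g 1#)) f0≡0 ⟩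
      0# * 1# + - (0# * g 1#)    ≡⟨ solve 1 (λ G → con (ℤ.+ 0) :* con (ℤ.+ 1) :+ :- (con (ℤ.+ 0) :* G) := con (ℤ.+ 0)) refl (g 1#) ⟩
      0#                         ∎)
    ... | no x≢0 with L⊆ x x≢0
    ...   | y , λ′ , y≢0 , x≡λ′y , fx≡λ′gy = y , y≢0 , (begin
      f x * y + - (x * g y)          ≡⟨ cong₂ (λ s t → s * y + - (t * g y)) fx≡λ′gy x≡λ′y ⟩
      λ′ * g y * y + - (λ′ * y * g y) ≡⟨ solve 3 (λ l G y → l :* G :* y :+ :- (l :* y :* G) := con (ℤ.+ 0)) refl λ′ (g y) y ⟩
      0#                              ∎)
    y = proj₁ witness
    y≢0 = proj₁ (proj₂ witness)
    F[y]≡0 = proj₂ (proj₂ witness)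

  detDicksonF-vanishes⇒inclusion : (∀ x → eval (detDicksonF K q n a b) x ≡ 0#) → LinSetSubset K f g
  detDicksonF-vanishes⇒inclusion vanishes x x≢0 = y , x * y⁻¹ , y≢0 , x≡xy⁻¹y , fx≡xy⁻¹gy
    where
    root = detK≡0⇒root (coeffFAt x) (trans (sym (eval-detDicksonF x)) (vanishes x))
    y = proj₁ root
    y≢0 = proj₁ (proj₂ root)
    y⁻¹ = proj₁ (inverse y y≢0)
    yy⁻¹≡1 = proj₂ (inverse y y≢0)
    fxy≡xgy : f x * y ≡ x * g y
    fxy≡xgy = begin
      f x * y                          ≡⟨ solve 2 (λ a b → a := a :+ :- b :+ b) refl (f x * y) (x * g y) ⟩
      f x * y + - (x * g y) + x * g y  ≡⟨ cong (_+ x * g y) (trans (sym (linearized-coeffFAt x y)) (proj₂ (proj₂ root))) ⟩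
      0# + x * g y                     ≡⟨ +-identityˡ _ ⟩
      x * g y                          ∎
    x≡xy⁻¹y : x ≡ x * y⁻¹ * y
    x≡xy⁻¹y = sym (trans (*-assoc x y⁻¹ y) (trans (cong (x *_) (trans (*-comm y⁻¹ y) yy⁻¹≡1)) (*-identityʳ x)))
    fx≡xy⁻¹gy : f x ≡ x * y⁻¹ * g y
    fx≡xy⁻¹gy = begin
      f x                ≡⟨ sym (*-identityʳ _) ⟩
      f x * 1#           ≡⟨ cong (f x *_) (sym yy⁻¹≡1) ⟩
      f x * (y * y⁻¹)    ≡⟨ sym (*-assoc _ _ _) ⟩
      f x * y * y⁻¹      ≡⟨ cong (_* y⁻¹) fxy≡xgy ⟩
      x * g y * y⁻¹      ≡⟨ solve 3 (λ x G i → x :* G :* i := x :* i :* G) refl x (g y) y⁻¹ ⟩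
      x * y⁻¹ * g y      ∎

  inclusion⇔vanishes : LinSetSubset K f g ⇔ (∀ x → eval (detDicksonF K q n a b) x ≡ 0#)
  inclusion⇔vanishes = mk⇔ inclusion⇒detDicksonF-vanishes detDicksonF-vanishes⇒inclusion

  2≤qⁿ : 2 ℕ.≤ q ℕ.^ n
  2≤qⁿ = ℕ.^-monoʳ-< q 1<q 0<n

open import Data.Nat using (_≤_; _^_)

proposition2p3 :
    (q n : ℕ) → IsPrimePower q → 2 ≤ n →
    (K : Field) → HasCardinality K (q ^ n) →
    (a b : Fin n → Field.Carrier K) →
      (LinSetSubset K (qPolyEval K q a) (qPolyEval K q b)
        ⇔ _∣P_ K (fieldPoly K q n) (detDicksonF K q n a b))
      × (DegLt K (detDicksonF K q n a b) (q ^ n) →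
          (LinSetSubset K (qPolyEval K q a) (qPolyEval K q b)
            ⇔ IsZeroPoly K (detDicksonF K q n a b)))
proposition2p3 q n q-primePower 2≤n K card a b =
  ⇔.trans inclusion⇔vanishes (⇔.sym (xᴺ-x∣⇔vanishes 2≤qⁿ (detDicksonF K q n a b))) ,
  λ deg → ⇔.trans inclusion⇔vanishes (degLt⇒vanishes⇔zero (detDicksonF K q n a b) deg)
  where
  open LinearSetInclusion K q-primePower 2≤n card a b
  open FiniteField K card
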